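{- Let $\Gamma$ be a graph on $n$ vertices that is $k$-regular and $\omega$-clique regular ($\omega\ge2$), and let $m=\frac{nk}{\omega(\omega-1)}$. Then \[p(C_\omega(\Gamma);\lambda)=(\lambda+\omega)^{m-n}\,p\!\left(\Gamma;\lambda+\omega-\frac{k}{\omega-1}\right).\]
   Context: All graphs are finite, without loops or parallel edges. A graph is $\omega$-clique regular if its edge set is nonempty and every edge lies in exactly one clique of order $\omega$ (set of $\omega$ pairwise adjacent vertices). The $\omega$-clique graph $C_\omega(\Gamma)$ has the cliques of order $\omega$ of $\Gamma$ as vertices, two distinct cliques being adjacent iff they have nonempty intersection. For a graph $H$ on $N$ vertices with adjacency matrix $A_H$, $p(H;\lambda)=\det(\lambda I_N-A_H)$ is its characteristic polynomial. -}

module Defs where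

open import Data.Bool using (Bool; true; false; if_then_else_)
open import Data.Nat as ℕ using (ℕ; zero; suc)
open import Data.Nat.DivMod using (_/_)
open import Data.Integer as ℤ using (ℤ; +_; -_)
open import Data.Fin using (Fin; zero; suc; punchIn)
open import Data.Fin.Properties using (_≟_)
open import Data.Fin.Subset using (Subset; _∈_; _∩_; ∣_∣)
open import Data.Fin.Subset.Properties using (nonempty?)
open import Data.Product using (Σ; ∃; ∃-syntax; _×_; _,_)
open import Relation.Binary.PropositionalEquality using (_≡_; _≢_)
open import Relation.Nullary using (does)

record Graph (n : ℕ) : Set where
  field
    adj   : Fin n → Fin n → Bool
    sym   : ∀ u v → adj u v ≡ adj v u
    irrefl : ∀ u → adj u u ≡ false
open Graph public

sumℕ : ∀ {n} → (Fin n → ℕ) → ℕ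
sumℕ {zero}  f = 0
sumℕ {suc n} f = f zero ℕ.+ sumℕ (λ i → f (suc i))

sumℤ : ∀ {n} → (Fin n → ℤ) → ℤ
sumℤ {zero}  f = + 0
sumℤ {suc n} f = f zero ℤ.+ sumℤ (λ i → f (suc i))

degree : ∀ {n} → Graph n → Fin n → ℕ
degree G u = sumℕ (λ v → if adj G u v then 1 else 0)

IsRegular : ∀ {n} → Graph n → ℕ → Set
IsRegular G k = ∀ u → degree G u ≡ k

IsClique : ∀ {n} → Graph n → ℕ → Subset n → Set
IsClique G ω S = (∣ S ∣ ≡ ω) × (∀ u v → u ∈ S → v ∈ S → u ≢ v → adj G u v ≡ true)

IsCliqueRegular : ∀ {n} → Graph n → ℕ → Set
IsCliqueRegular G ω =
  (∃[ u ] ∃[ v ] adj G u v ≡ true) ×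
  (∀ u v → adj G u v ≡ true →
     (∃[ S ] (IsClique G ω S × u ∈ S × v ∈ S)) ×
     (∀ S T → IsClique G ω S → u ∈ S → v ∈ S →
              IsClique G ω T → u ∈ T → v ∈ T → S ≡ T))

IsCliqueEnumeration : ∀ {n} → Graph n → ℕ → (N : ℕ) → (Fin N → Subset n) → Set
IsCliqueEnumeration G ω N e =
  (∀ i → IsClique G ω (e i)) ×
  (∀ i j → e i ≡ e j → i ≡ j) ×
  (∀ S → IsClique G ω S → ∃[ i ] e i ≡ S)

cliqueGraphAdj : ∀ {n N} → (Fin N → Subset n) → Fin N → Fin N → ℤ
cliqueGraphAdj e i j =
  if does (i ≟ j) then + 0 else (if does (nonempty? (e i ∩ e j)) then + 1 else + 0)

adjMatrix : ∀ {n} → Graph n → Fin n → Fin n → ℤ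
adjMatrix G u v = if adj G u v then + 1 else + 0

sign : ℕ → ℤ
sign zero = + 1
sign (suc zero) = - (+ 1)
sign (suc (suc j)) = sign j

toℕ' : ∀ {n} → Fin n → ℕ
toℕ' zero = 0
toℕ' (suc i) = suc (toℕ' i)

det : ∀ {n} → (Fin n → Fin n → ℤ) → ℤ
det {zero}  M = + 1
det {suc n} M = sumℤ (λ j → sign (toℕ' j) ℤ.* (M zero j ℤ.* det (λ r c → M (suc r) (punchIn j c))))

-- characteristic polynomial p(H;λ) = det(λ I − A_H), evaluated at λ ∈ ℤ
charPolyAt : ∀ {N} → (Fin N → Fin N → ℤ) → ℤ → ℤ
charPolyAt {N} A λ' = det (λ i j → (if does (i ≟ j) then λ' else + 0) ℤ.- A i j)

-- natural-number division (exact in all uses here); divisor 0 gives 0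
divℕ : ℕ → ℕ → ℕ
divℕ a zero = 0
divℕ a (suc d) = a / suc d

module Submission where

-- Let M be the n × N vertex–clique incidence matrix of Γ. As every edge lies in exactly one
-- ω-clique, two distinct cliques share at most one vertex and each vertex lies in r = k/(ω-1)
-- cliques, so M Mᵀ = A(Γ) + r I and Mᵀ M = A(C_ω(Γ)) + ω I, and double counting the incidences
-- gives N = nk/(ω(ω-1)) = m. The theorem is then Sylvester's identity
-- p(Mᵀ M; x) = x^(N-n) p(M Mᵀ; x), which reduces, by padding M with zero rows, to
-- p(AB; x) = p(BA; x) for square A and B. For x ≠ 0 this follows by cancelling x^n after computing
-- det [[x, A], [B, 1]] · det [[1, -A], [0, x]] through block factorisations; for x = 0 it is
-- det (AB) = det A · det B, which holds because det is the unique alternating multilinear form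
-- taking the value 1 at the identity.

open import Defs hiding (sym)
open import Data.Bool using (Bool; true; false; if_then_else_; _∧_)
open import Data.Empty using (⊥-elim)
open import Data.Fin using (Fin; zero; suc; punchIn; _↑ˡ_; _↑ʳ_)
open import Data.Fin.Properties using (_≟_)
open import Data.Fin.Subset using (Subset; _∈_; _∩_; ∣_∣)
open import Data.Fin.Subset.Properties using (nonempty?)
open import Data.Integer as ℤ using (ℤ; +_; 0ℤ; 1ℤ; -1ℤ; -_; _+_; _*_; _-_; _^_; ≢-nonZero)
import Data.Integer.Properties as ℤP
open import Data.Integer.Tactic.RingSolver using (solve-∀)
open import Data.Nat as ℕ using (ℕ; zero; suc; _≤_; _∸_; s≤s; z≤n)
import Data.Nat.Properties as ℕP
open import Data.Nat.DivMod using (_/_; m*n/n≡m)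
open import Data.Product using (_×_; _,_; proj₁; proj₂)
open import Data.Vec as Vec using (lookup)
open import Data.Vec.Properties using ([]=⇒lookup; lookup⇒[]=; lookup-zipWith)
open import Data.Vec.Functional using (Vector; _∷_; _++_; tail; map; removeAt; insertAt; updateAt)
open import Data.Vec.Functional.Properties
  using (updateAt-id-local; updateAt-updates; updateAt-minimal; updateAt-commutes; map-updateAt; lookup-++ˡ; lookup-++ʳ)
open import Function using (_∘_; const)
open import Relation.Binary.PropositionalEquality
  using (_≡_; _≢_; _≗_; refl; sym; trans; cong; cong₂; cong-app; subst; module ≡-Reasoning)
open import Relation.Nullary using (does; yes; no; contradiction)

open import Algebra.Properties.Semiring.Sum ℤP.+-*-semiring
  using (sum; sum-syntax; sum-cong-≗; ∑-distrib-+; ∑-comm; *-distribˡ-sum; *-distribʳ-sum; sum-replicate-zero)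

variable
  a b c d m n : ℕ

sumℤ≡sum : (f : Fin n → ℤ) → sumℤ f ≡ sum f
sumℤ≡sum {zero}  f = refl
sumℤ≡sum {suc n} f = cong (_+_ (f zero)) (sumℤ≡sum (f ∘ suc))

∑-zero : (f : Fin n → ℤ) → (∀ i → f i ≡ 0ℤ) → sum f ≡ 0ℤ
∑-zero {n} f f≗0 = trans (sum-cong-≗ f≗0) (sum-replicate-zero n)

∑-neg : (f : Fin n → ℤ) → ∑[ i < n ] (- f i) ≡ - sum f
∑-neg f = trans (sum-cong-≗ (λ i → sym (ℤP.-1*i≡-i (f i))))
                (trans (sym (*-distribˡ-sum -1ℤ f)) (ℤP.-1*i≡-i (sum f)))

∑-linear : ∀ α β (f g : Fin n → ℤ) →
           ∑[ i < n ] (α * f i + β * g i) ≡ α * sum f + β * sum g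
∑-linear α β f g = trans (∑-distrib-+ (λ i → α * f i) (λ i → β * g i))
  (sym (cong₂ _+_ (*-distribˡ-sum α f) (*-distribˡ-sum β g)))

Matrix : ℕ → ℕ → Set
Matrix m n = Fin m → Fin n → ℤ

infix 4 _≋_
_≋_ : Matrix m n → Matrix m n → Set
X ≋ Y = ∀ i j → X i j ≡ Y i j

_[_]≔_ : {A : Set} → Vector A n → Fin n → A → Vector A n
X [ i ]≔ w = updateAt X i (const w)

map-≔ : ∀ {A B : Set} (f : A → B) (X : Vector A n) i w → map f (X [ i ]≔ w) ≗ (map f X) [ i ]≔ f w
map-≔ f X i w = map-updateAt {f = f} (λ _ → refl) X i

≔-cong : ∀ {A : Set} (X : Vector (Vector A n) m) i {w w′ : Vector A n} → w ≗ w′ →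
         ∀ r c → (X [ i ]≔ w) r c ≡ (X [ i ]≔ w′) r c
≔-cong X zero    w≗w′ zero    c = w≗w′ c
≔-cong X zero    w≗w′ (suc r) c = refl
≔-cong X (suc i) w≗w′ zero    c = refl
≔-cong X (suc i) w≗w′ (suc r) c = ≔-cong (tail X) i w≗w′ r c

≔-self : (X : Matrix m n) (i : Fin m) → X [ i ]≔ X i ≋ X
≔-self X i r = cong-app (updateAt-id-local i X refl r)

scalar : ℤ → Matrix n n
scalar x i j = if does (i ≟ j) then x else 0ℤ

1ₘ : Matrix n n
1ₘ = scalar 1ℤ

∑-scalarˡ : ∀ x (i : Fin n) (f : Fin n → ℤ) → ∑[ k < n ] (scalar x i k * f k) ≡ x * f i
∑-scalarˡ x zero    f = trans (cong (_+_ (x * f zero)) (∑-zero (λ k → 0ℤ * f (suc k)) λ _ → refl))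
                              (ℤP.+-identityʳ (x * f zero))
∑-scalarˡ x (suc i) f = trans (ℤP.+-identityˡ _) (∑-scalarˡ x i (f ∘ suc))

∑-scalarʳ : ∀ x (i : Fin n) (f : Fin n → ℤ) → ∑[ k < n ] (f k * scalar x k i) ≡ f i * x
∑-scalarʳ x zero    f = trans (cong (_+_ (f zero * x)) (∑-zero (λ k → f (suc k) * 0ℤ) λ k → ℤP.*-zeroʳ (f (suc k))))
                              (ℤP.+-identityʳ (f zero * x))
∑-scalarʳ x (suc i) f = trans (cong (_+ ∑[ k < _ ] (f (suc k) * scalar x k i)) (ℤP.*-zeroʳ (f zero)))
                              (trans (ℤP.+-identityˡ _) (∑-scalarʳ x i (f ∘ suc)))

sgn : Fin n → ℤ
sgn j = sign (toℕ' j)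

minor : Fin (suc n) → Matrix (suc n) (suc n) → Matrix n n
minor j X r = removeAt (X (suc r)) j

laplaceTerm : Matrix (suc n) (suc n) → Fin (suc n) → ℤ
laplaceTerm X j = sgn j * (X zero j * det (minor j X))

det-expand : (X : Matrix (suc n) (suc n)) → det X ≡ sum (laplaceTerm X)
det-expand X = sumℤ≡sum (laplaceTerm X)

det-cong : {X Y : Matrix n n} → X ≋ Y → det X ≡ det Y
det-cong {zero}          X≋Y = refl
det-cong {suc n} {X} {Y} X≋Y = begin
  det X                   ≡⟨ det-expand X ⟩
  sum (laplaceTerm X)     ≡⟨ sum-cong-≗ term-cong ⟩
  sum (laplaceTerm Y)     ≡⟨ det-expand Y ⟨
  det Y                   ∎
  where
  open ≡-Reasoning
  term-cong : ∀ j → laplaceTerm X j ≡ laplaceTerm Y j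
  term-cong j = cong (sgn j *_) (cong₂ _*_ (X≋Y zero j) (det-cong λ r c → X≋Y (suc r) (punchIn j c)))

minor-≔ : ∀ j (X : Matrix (suc n) (suc n)) i w → minor j (X [ suc i ]≔ w) ≋ minor j X [ i ]≔ removeAt w j
minor-≔ j X i w r = cong-app (map-≔ (λ row → removeAt row j) (tail X) i w r)

det-linear : ∀ (X : Matrix n n) i (u v : Vector ℤ n) α β →
             det (X [ i ]≔ (λ c → α * u c + β * v c)) ≡ α * det (X [ i ]≔ u) + β * det (X [ i ]≔ v)
det-linear {suc n} X zero u v α β = begin
  det (X [ zero ]≔ w)                                              ≡⟨ det-expand (X [ zero ]≔ w) ⟩
  ∑[ j < suc n ] (sgn j * (w j * D j))                            ≡⟨ sum-cong-≗ (λ j → distrib α β (sgn j) (u j) (v j) (D j)) ⟩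
  ∑[ j < suc n ] (α * (sgn j * (u j * D j)) + β * (sgn j * (v j * D j))) ≡⟨ ∑-linear α β (λ j → sgn j * (u j * D j)) (λ j → sgn j * (v j * D j)) ⟩
  α * ∑[ j < suc n ] (sgn j * (u j * D j)) + β * ∑[ j < suc n ] (sgn j * (v j * D j))
    ≡⟨ cong₂ (λ p q → α * p + β * q) (det-expand (X [ zero ]≔ u)) (det-expand (X [ zero ]≔ v)) ⟨
  α * det (X [ zero ]≔ u) + β * det (X [ zero ]≔ v)              ∎
  where
  open ≡-Reasoning
  w = λ c → α * u c + β * v c
  D = λ j → det (minor j X)
  distrib : ∀ α β s x y D → s * ((α * x + β * y) * D) ≡ α * (s * (x * D)) + β * (s * (y * D))
  distrib = solve-∀
det-linear {suc n} X (suc i) u v α β = begin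
  det (X [ suc i ]≔ w)                                             ≡⟨ det-expand (X [ suc i ]≔ w) ⟩
  ∑[ j < suc n ] (sgn j * (X zero j * det (minor j (X [ suc i ]≔ w)))) ≡⟨ sum-cong-≗ term ⟩
  ∑[ j < suc n ] (α * (sgn j * (X zero j * Du j)) + β * (sgn j * (X zero j * Dv j)))
    ≡⟨ ∑-linear α β (λ j → sgn j * (X zero j * Du j)) (λ j → sgn j * (X zero j * Dv j)) ⟩
  α * ∑[ j < suc n ] (sgn j * (X zero j * Du j)) + β * ∑[ j < suc n ] (sgn j * (X zero j * Dv j))
    ≡⟨ cong₂ (λ p q → α * p + β * q) (det-expand (X [ suc i ]≔ u)) (det-expand (X [ suc i ]≔ v)) ⟨
  α * det (X [ suc i ]≔ u) + β * det (X [ suc i ]≔ v)            ∎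
  where
  open ≡-Reasoning
  w = λ c → α * u c + β * v c
  Du = λ j → det (minor j (X [ suc i ]≔ u))
  Dv = λ j → det (minor j (X [ suc i ]≔ v))
  distrib : ∀ α β s x P Q → s * (x * (α * P + β * Q)) ≡ α * (s * (x * P)) + β * (s * (x * Q))
  distrib = solve-∀
  det-minor : ∀ j w → det (minor j (X [ suc i ]≔ w)) ≡ det (minor j X [ i ]≔ removeAt w j)
  det-minor j w = det-cong (minor-≔ j X i w)
  term : ∀ j → sgn j * (X zero j * det (minor j (X [ suc i ]≔ w)))
             ≡ α * (sgn j * (X zero j * Du j)) + β * (sgn j * (X zero j * Dv j))
  term j = trans (cong (λ D → sgn j * (X zero j * D))
                   (trans (det-minor j w)
                   (trans (det-linear (minor j X) i (removeAt u j) (removeAt v j) α β)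
                          (sym (cong₂ (λ p q → α * p + β * q) (det-minor j u) (det-minor j v))))))
                 (distrib α β (sgn j) (X zero j) (Du j) (Dv j))

IsAlternating : (Matrix m n → ℤ) → Set
IsAlternating {m} {n} f = ∀ (X : Matrix m n) {p q} → p ≢ q → X p ≗ X q → f X ≡ 0ℤ

record IsMultilinear (f : Matrix m n → ℤ) : Set where
  field
    cong-≋ : ∀ {X Y} → X ≋ Y → f X ≡ f Y
    linear : ∀ X i (u v : Vector ℤ n) α β →
             f (X [ i ]≔ (λ c → α * u c + β * v c)) ≡ α * f (X [ i ]≔ u) + β * f (X [ i ]≔ v)

  additive : ∀ X i (u v : Vector ℤ n) → f (X [ i ]≔ (λ c → u c + v c)) ≡ f (X [ i ]≔ u) + f (X [ i ]≔ v)
  additive X i u v = begin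
    f (X [ i ]≔ (λ c → u c + v c))           ≡⟨ cong-≋ (≔-cong X i λ c → sym (cong₂ _+_ (ℤP.*-identityˡ (u c)) (ℤP.*-identityˡ (v c)))) ⟩
    f (X [ i ]≔ (λ c → 1ℤ * u c + 1ℤ * v c)) ≡⟨ linear X i u v 1ℤ 1ℤ ⟩
    1ℤ * f (X [ i ]≔ u) + 1ℤ * f (X [ i ]≔ v) ≡⟨ cong₂ _+_ (ℤP.*-identityˡ (f (X [ i ]≔ u))) (ℤP.*-identityˡ (f (X [ i ]≔ v))) ⟩
    f (X [ i ]≔ u) + f (X [ i ]≔ v)           ∎
    where open ≡-Reasoning

  zero-row : ∀ X i → f (X [ i ]≔ (λ _ → 0ℤ)) ≡ 0ℤ
  zero-row X i = trans (linear X i (λ _ → 0ℤ) (λ _ → 0ℤ) 0ℤ 0ℤ) refl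

  linear-∑ : ∀ X i {K} (α : Fin K → ℤ) (v : Fin K → Vector ℤ n) →
             f (X [ i ]≔ (λ c → ∑[ k < K ] (α k * v k c))) ≡ ∑[ k < K ] (α k * f (X [ i ]≔ v k))
  linear-∑ X i {zero}  α v = zero-row X i
  linear-∑ X i {suc K} α v = begin
    f (X [ i ]≔ (λ c → α zero * v zero c + rest c))
      ≡⟨ cong-≋ (≔-cong X i λ c → cong (_+_ (α zero * v zero c)) (sym (ℤP.*-identityˡ (rest c)))) ⟩
    f (X [ i ]≔ (λ c → α zero * v zero c + 1ℤ * rest c))   ≡⟨ linear X i (v zero) rest (α zero) 1ℤ ⟩
    α zero * f (X [ i ]≔ v zero) + 1ℤ * f (X [ i ]≔ rest)
      ≡⟨ cong (_+_ (α zero * f (X [ i ]≔ v zero))) (trans (ℤP.*-identityˡ _) (linear-∑ X i (α ∘ suc) (v ∘ suc))) ⟩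
    ∑[ k < suc K ] (α k * f (X [ i ]≔ v k))               ∎
    where
    open ≡-Reasoning
    rest = λ c → ∑[ k < K ] (α (suc k) * v (suc k) c)

swapRows : {A : Set} → Fin m → Fin m → Vector A m → Vector A m
swapRows p q X = (X [ p ]≔ X q) [ q ]≔ X p

-- Expanding F (u + v) (u + v) = 0 by additivity in both rows leaves F u v + F v u = 0.
swapRows-negates : ∀ {f : Matrix m n → ℤ} → IsMultilinear f → ∀ {p q} → p ≢ q →
                   (∀ X → X p ≗ X q → f X ≡ 0ℤ) → ∀ X → f (swapRows p q X) ≡ - f X
swapRows-negates {f = f} ml {p} {q} p≢q alt X = begin
  F v u                     ≡⟨ neg-cancel (F u v) (F v u) ⟩
  - F u v + (F u v + F v u) ≡⟨ cong (λ s → - F u v + s) F-antisym ⟩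
  - F u v + 0ℤ              ≡⟨ ℤP.+-identityʳ _ ⟩
  - F u v                   ≡⟨ cong -_ F-self ⟩
  - f X                     ∎
  where
  open ≡-Reasoning
  open IsMultilinear ml
  u = X p
  v = X q
  F : Vector ℤ _ → Vector ℤ _ → ℤ
  F s t = f ((X [ p ]≔ s) [ q ]≔ t)
  _⊕_ : Vector ℤ _ → Vector ℤ _ → Vector ℤ _
  (s ⊕ t) c = s c + t c
  neg-cancel : ∀ a b → b ≡ - a + (a + b)
  neg-cancel = solve-∀
  F-diag : ∀ s → F s s ≡ 0ℤ
  F-diag s = alt _ λ c → cong-app (trans (updateAt-minimal p q (X [ p ]≔ s) p≢q)
                                  (trans (updateAt-updates p X) (sym (updateAt-updates q (X [ p ]≔ s))))) c
  F-additiveʳ : ∀ s t t′ → F s (t ⊕ t′) ≡ F s t + F s t′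
  F-additiveʳ s = additive (X [ p ]≔ s) q
  F-comm : ∀ s t → F s t ≡ f ((X [ q ]≔ t) [ p ]≔ s)
  F-comm s t = cong-≋ λ r → cong-app (updateAt-commutes q p (p≢q ∘ sym) X r)
  F-additiveˡ : ∀ s s′ t → F (s ⊕ s′) t ≡ F s t + F s′ t
  F-additiveˡ s s′ t = trans (F-comm (s ⊕ s′) t)
    (trans (additive (X [ q ]≔ t) p s s′) (sym (cong₂ _+_ (F-comm s t) (F-comm s′ t))))
  F-antisym : F u v + F v u ≡ 0ℤ
  F-antisym = begin
    F u v + F v u                         ≡⟨ cong₂ _+_ (ℤP.+-identityˡ (F u v)) (ℤP.+-identityʳ (F v u)) ⟨
    (0ℤ + F u v) + (F v u + 0ℤ)           ≡⟨ cong₂ (λ a b → (a + F u v) + (F v u + b)) (F-diag u) (F-diag v) ⟨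
    (F u u + F u v) + (F v u + F v v)     ≡⟨ cong₂ _+_ (F-additiveʳ u u v) (F-additiveʳ v u v) ⟨
    F u (u ⊕ v) + F v (u ⊕ v)             ≡⟨ F-additiveˡ u v (u ⊕ v) ⟨
    F (u ⊕ v) (u ⊕ v)                     ≡⟨ F-diag (u ⊕ v) ⟩
    0ℤ                                    ∎
  F-self : F u v ≡ f X
  F-self = cong-≋ λ r c → trans (≔-cong (X [ p ]≔ u) q (λ c → sym (≔-self X p q c)) r c)
                         (trans (≔-self (X [ p ]≔ u) q r c) (≔-self X p r c))

det-isMultilinear : IsMultilinear (det {n})
det-isMultilinear = record { cong-≋ = det-cong ; linear = det-linear }

sign-suc : ∀ k → sign (suc k) ≡ - sign k
sign-suc zero    = refl
sign-suc (suc k) = sym (trans (cong -_ (sign-suc k)) (ℤP.neg-involutive (sign k)))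

sgn-suc : (j : Fin n) → sgn (suc j) ≡ - sgn j
sgn-suc j = sign-suc (toℕ' j)

-- The shape of a double Laplace expansion along two equal rows: the terms for (c, c′) and (c′, c) cancel.
∑-sgn-punchIn-symmetric : (T : Fin (suc n) → Fin (suc n) → ℤ) → (∀ a b → T a b ≡ T b a) →
                          ∑[ c < suc n ] (sgn c * ∑[ d < n ] (sgn d * T c (punchIn c d))) ≡ 0ℤ
∑-sgn-punchIn-symmetric {zero}  T T-sym = refl
∑-sgn-punchIn-symmetric {suc n} T T-sym = begin
  1ℤ * A + ∑[ c < suc n ] (sgn (suc c) * (1ℤ * T (suc c) zero + ∑[ d < n ] (sgn (suc d) * T′ c (punchIn c d))))
    ≡⟨ cong₂ _+_ (ℤP.*-identityˡ A) (sum-cong-≗ row) ⟩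
  A + ∑[ c < suc n ] (- (sgn c * T (suc c) zero) + sgn c * S c)
    ≡⟨ cong (_+_ A) (∑-distrib-+ (λ c → - (sgn c * T (suc c) zero)) (λ c → sgn c * S c)) ⟩
  A + (∑[ c < suc n ] (- (sgn c * T (suc c) zero)) + ∑[ c < suc n ] (sgn c * S c))
    ≡⟨ cong₂ (λ x y → A + (x + y)) (∑-neg (λ c → sgn c * T (suc c) zero))
                                   (∑-sgn-punchIn-symmetric T′ (λ a b → T-sym (suc a) (suc b))) ⟩
  A + (- B + 0ℤ)
    ≡⟨ cong (λ a → a + (- B + 0ℤ)) A≡B ⟩
  B + (- B + 0ℤ)
    ≡⟨ cancel B ⟩
  0ℤ ∎
  where
  open ≡-Reasoning
  T′ : Fin (suc n) → Fin (suc n) → ℤ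
  T′ a b = T (suc a) (suc b)
  A = ∑[ d < suc n ] (sgn d * T zero (suc d))
  B = ∑[ c < suc n ] (sgn c * T (suc c) zero)
  S : Fin (suc n) → ℤ
  S c = ∑[ d < n ] (sgn d * T′ c (punchIn c d))
  A≡B : A ≡ B
  A≡B = sum-cong-≗ λ d → cong (sgn d *_) (T-sym zero (suc d))
  cancel : ∀ b → b + (- b + 0ℤ) ≡ 0ℤ
  cancel = solve-∀
  negate : ∀ s t S → - s * (1ℤ * t + - S) ≡ - (s * t) + s * S
  negate = solve-∀
  row : ∀ c → sgn (suc c) * (1ℤ * T (suc c) zero + ∑[ d < n ] (sgn (suc d) * T′ c (punchIn c d)))
            ≡ - (sgn c * T (suc c) zero) + sgn c * S c
  row c = trans (cong₂ (λ s S′ → s * (1ℤ * T (suc c) zero + S′)) (sgn-suc c)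
                  (trans (sum-cong-≗ λ d → trans (cong (_* T′ c (punchIn c d)) (sgn-suc d))
                                                 (sym (ℤP.neg-distribˡ-* (sgn d) (T′ c (punchIn c d)))))
                         (∑-neg (λ d → sgn d * T′ c (punchIn c d)))))
                (negate (sgn c) (T (suc c) zero) (S c))

-- For a ≢ b, the increasing enumeration of Fin (2 + n) without a and b.
punchIn₂ : Fin (suc (suc n)) → Fin (suc (suc n)) → Fin n → Fin (suc (suc n))
punchIn₂         zero    zero    k       = suc (suc k)
punchIn₂         zero    (suc b) k       = suc (punchIn b k)
punchIn₂         (suc a) zero    k       = suc (punchIn a k)
punchIn₂ {suc n} (suc a) (suc b) zero    = zero
punchIn₂ {suc n} (suc a) (suc b) (suc k) = suc (punchIn₂ a b k)

punchIn₂-comm : (a b : Fin (suc (suc n))) → punchIn₂ a b ≗ punchIn₂ b a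
punchIn₂-comm         zero    zero    k       = refl
punchIn₂-comm         zero    (suc b) k       = refl
punchIn₂-comm         (suc a) zero    k       = refl
punchIn₂-comm {suc n} (suc a) (suc b) zero    = refl
punchIn₂-comm {suc n} (suc a) (suc b) (suc k) = cong suc (punchIn₂-comm a b k)

punchIn-punchIn : (a : Fin (suc (suc n))) (b : Fin (suc n)) → punchIn a ∘ punchIn b ≗ punchIn₂ a (punchIn a b)
punchIn-punchIn         zero    b       k       = refl
punchIn-punchIn         (suc a) zero    k       = refl
punchIn-punchIn {suc n} (suc a) (suc b) zero    = refl
punchIn-punchIn {suc n} (suc a) (suc b) (suc k) = cong suc (punchIn-punchIn a b k)

det-rows₀₁ : (X : Matrix (suc (suc n)) (suc (suc n))) → X zero ≗ X (suc zero) → det X ≡ 0ℤ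
det-rows₀₁ {n} X X₀≗X₁ = trans (det-expand X) (trans (sum-cong-≗ term) (∑-sgn-punchIn-symmetric T T-sym))
  where
  D : Fin (suc (suc n)) → Fin (suc (suc n)) → ℤ
  D a b = det λ r k → X (suc (suc r)) (punchIn₂ a b k)
  T : Fin (suc (suc n)) → Fin (suc (suc n)) → ℤ
  T a b = X zero a * (X zero b * D a b)
  swap-factors : ∀ x y z → x * (y * z) ≡ y * (x * z)
  swap-factors = solve-∀
  T-sym : ∀ a b → T a b ≡ T b a
  T-sym a b = trans (cong (λ z → X zero a * (X zero b * z)) (det-cong λ r k → cong (X (suc (suc r))) (punchIn₂-comm a b k)))
                    (swap-factors (X zero a) (X zero b) (D b a))
  regroup : ∀ x s y z → x * (s * (y * z)) ≡ s * (x * (y * z))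
  regroup = solve-∀
  inner : ∀ c d → X zero c * (sgn d * (X (suc zero) (punchIn c d) * det (minor d (minor c X))))
                ≡ sgn d * T c (punchIn c d)
  inner c d = trans (cong₂ (λ y z → X zero c * (sgn d * (y * z))) (sym (X₀≗X₁ (punchIn c d)))
                           (det-cong λ r k → cong (X (suc (suc r))) (punchIn-punchIn c d k)))
                    (regroup (X zero c) (sgn d) (X zero (punchIn c d)) (D c (punchIn c d)))
  term : ∀ c → sgn c * (X zero c * det (minor c X)) ≡ sgn c * ∑[ d < suc n ] (sgn d * T c (punchIn c d))
  term c = cong (sgn c *_) (trans (cong (X zero c *_) (det-expand (minor c X)))
                           (trans (*-distribˡ-sum (X zero c) (λ d → sgn d * (X (suc zero) (punchIn c d) * det (minor d (minor c X)))))
                                  (sum-cong-≗ (inner c))))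

det-tail-alternating : IsAlternating (det {n}) → ∀ (X : Matrix (suc n) (suc n)) {p q} →
                       p ≢ q → X (suc p) ≗ X (suc q) → det X ≡ 0ℤ
det-tail-alternating alt X p≢q eq = trans (det-expand X) (∑-zero (laplaceTerm X) λ j →
  trans (cong (λ D → sgn j * (X zero j * D)) (alt (minor j X) p≢q (eq ∘ punchIn j)))
        (trans (cong (sgn j *_) (ℤP.*-zeroʳ (X zero j))) (ℤP.*-zeroʳ (sgn j))))

-- For q ≥ 1, swapping rows 1 and q + 1 negates det and leaves rows 0 and 1 equal.
det-head-alternating : IsAlternating (det {n}) → ∀ (X : Matrix (suc n) (suc n)) q →
                       X zero ≗ X (suc q) → det X ≡ 0ℤ
det-head-alternating         alt X zero    eq = det-rows₀₁ X eq
det-head-alternating {suc n} alt X (suc q) eq = begin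
  det X              ≡⟨ ℤP.neg-involutive (det X) ⟨
  - - det X          ≡⟨ cong -_ (swapRows-negates det-isMultilinear {suc zero} {suc (suc q)} (λ ()) (λ Y → det-tail-alternating alt Y (λ ())) X) ⟨
  - det (swapRows (suc zero) (suc (suc q)) X) ≡⟨ cong -_ (det-rows₀₁ (swapRows (suc zero) (suc (suc q)) X) eq) ⟩
  - 0ℤ               ∎
  where open ≡-Reasoning

det-alternating : IsAlternating (det {n})
det-alternating {suc n} X {zero}  {zero}  0≢0 _  = ⊥-elim (0≢0 refl)
det-alternating {suc n} X {zero}  {suc q} _   eq = det-head-alternating det-alternating X q eq
det-alternating {suc n} X {suc p} {zero}  _   eq = det-head-alternating det-alternating X p (sym ∘ eq)
det-alternating {suc n} X {suc p} {suc q} p≢q eq = det-tail-alternating det-alternating X (p≢q ∘ cong suc) eq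

record IsAlternatingMultilinear (f : Matrix m n → ℤ) : Set where
  field
    isMultilinear : IsMultilinear f
    alternating   : IsAlternating f
  open IsMultilinear isMultilinear public

det-isAlternatingMultilinear : IsAlternatingMultilinear (det {n})
det-isAlternatingMultilinear = record { isMultilinear = det-isMultilinear ; alternating = det-alternating }

∷-≔ : ∀ (w : Vector ℤ n) (Z : Matrix m n) i v → (w ∷ Z) [ suc i ]≔ v ≋ w ∷ (Z [ i ]≔ v)
∷-≔ w Z i v zero    c = refl
∷-≔ w Z i v (suc r) c = refl

∷-isAlternatingMultilinear : ∀ {f : Matrix (suc m) n → ℤ} → IsAlternatingMultilinear f →
                             ∀ w → IsAlternatingMultilinear (λ Z → f (w ∷ Z))
∷-isAlternatingMultilinear {f = f} am w = record
  { isMultilinear = record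
    { cong-≋ = λ Z≋Z′ → cong-≋ λ { zero c → refl ; (suc r) c → Z≋Z′ r c }
    ; linear = λ Z i u v α β → trans (cong-≋ (λ r c → sym (∷-≔ w Z i _ r c)))
                                 (trans (linear (w ∷ Z) (suc i) u v α β)
                                        (cong₂ (λ x y → α * x + β * y) (cong-≋ (∷-≔ w Z i u)) (cong-≋ (∷-≔ w Z i v))))
    }
  ; alternating = λ Z p≢q eq → alternating (w ∷ Z) (p≢q ∘ suc-injective) eq
  }
  where
  open IsAlternatingMultilinear am
  suc-injective : ∀ {k} {p q : Fin k} → _≡_ {A = Fin (suc k)} (suc p) (suc q) → p ≡ q
  suc-injective refl = refl

map-isAlternatingMultilinear : ∀ {f : Matrix m n → ℤ} → IsAlternatingMultilinear f →
  (ψ : Vector ℤ a → Vector ℤ n) → (∀ {u v} → u ≗ v → ψ u ≗ ψ v) →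
  (∀ u v α β → ψ (λ c → α * u c + β * v c) ≗ λ c → α * ψ u c + β * ψ v c) →
  IsAlternatingMultilinear (λ Y → f (map ψ Y))
map-isAlternatingMultilinear {f = f} am ψ ψ-cong ψ-linear = record
  { isMultilinear = record
    { cong-≋ = λ Y≋Y′ → cong-≋ λ r → ψ-cong (Y≋Y′ r)
    ; linear = λ Y i u v α β →
        trans (cong-≋ λ r c → trans (cong-app (map-≔ ψ Y i _ r) c) (≔-cong (map ψ Y) i (ψ-linear u v α β) r c))
              (trans (linear (map ψ Y) i (ψ u) (ψ v) α β)
                     (sym (cong₂ (λ x y → α * x + β * y) (cong-≋ λ r → cong-app (map-≔ ψ Y i u r))
                                                         (cong-≋ λ r → cong-app (map-≔ ψ Y i v r)))))
    }
  ; alternating = λ Y p≢q eq → alternating (map ψ Y) p≢q (ψ-cong eq)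
  }
  where open IsAlternatingMultilinear am

map-rows-invariant : ∀ {f : Matrix m n → ℤ} → (∀ {X Y} → X ≋ Y → f X ≡ f Y) → (φ : Vector ℤ n → Vector ℤ n) →
                     (∀ X i → f (X [ i ]≔ φ (X i)) ≡ f X) → ∀ X → f (map φ X) ≡ f X
map-rows-invariant {zero}          f-cong φ inv X = f-cong λ ()
map-rows-invariant {suc m} {f = f} f-cong φ inv X = begin
  f (map φ X)                       ≡⟨ f-cong (λ { zero c → refl ; (suc r) c → refl }) ⟩
  g (map φ (tail X))                ≡⟨ map-rows-invariant g-cong φ g-inv (tail X) ⟩
  g (tail X)                        ≡⟨ f-cong (λ { zero c → refl ; (suc r) c → refl }) ⟩
  f (X [ zero ]≔ φ (X zero))        ≡⟨ inv X zero ⟩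
  f X                               ∎
  where
  open ≡-Reasoning
  g : Matrix m _ → ℤ
  g Z = f (φ (X zero) ∷ Z)
  g-cong : ∀ {Z Z′} → Z ≋ Z′ → g Z ≡ g Z′
  g-cong Z≋Z′ = f-cong λ { zero c → refl ; (suc r) c → Z≋Z′ r c }
  g-inv : ∀ Z i → g (Z [ i ]≔ φ (Z i)) ≡ g Z
  g-inv Z i = trans (f-cong (λ r c → sym (∷-≔ (φ (X zero)) Z i (φ (Z i)) r c))) (inv (φ (X zero) ∷ Z) (suc i))

toTop : {A : Set} → Fin (suc n) → Vector A (suc n) → Vector A (suc n)
toTop j X = X j ∷ removeAt X j

toTop-sign : ∀ {f : Matrix (suc m) n → ℤ} → IsAlternatingMultilinear f → ∀ j X → f (toTop j X) ≡ sgn j * f X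
toTop-sign {f = f} am zero    X = trans (cong-≋ λ { zero c → refl ; (suc r) c → refl }) (sym (ℤP.*-identityˡ (f X)))
  where open IsAlternatingMultilinear am
toTop-sign {suc m} {f = f} am (suc j) X = begin
  f (toTop (suc j) X)                                    ≡⟨ cong-≋ (λ { zero c → refl ; (suc zero) c → refl ; (suc (suc r)) c → refl }) ⟩
  f (swapRows zero (suc zero) (X zero ∷ toTop j (tail X))) ≡⟨ swapRows-negates isMultilinear {zero} {suc zero} (λ ()) (λ Y → alternating Y (λ ())) _ ⟩
  - f (X zero ∷ toTop j (tail X))                        ≡⟨ cong -_ (toTop-sign (∷-isAlternatingMultilinear am (X zero)) j (tail X)) ⟩
  - (sgn j * f (X zero ∷ tail X))                        ≡⟨ cong (λ y → - (sgn j * y)) (cong-≋ λ { zero c → refl ; (suc r) c → refl }) ⟩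
  - (sgn j * f X)                                        ≡⟨ ℤP.neg-distribˡ-* (sgn j) (f X) ⟩
  - sgn j * f X                                          ≡⟨ cong (_* f X) (sgn-suc j) ⟨
  sgn (suc j) * f X                                      ∎
  where
  open ≡-Reasoning
  open IsAlternatingMultilinear am

clearColumn : Fin (suc n) → Vector ℤ (suc n) → Vector ℤ (suc n)
clearColumn j w = insertAt (removeAt w j) j 0ℤ

clearColumn-split : ∀ j (w : Vector ℤ (suc n)) c → w c ≡ 1ℤ * clearColumn j w c + w j * 1ₘ j c
clearColumn-split         zero    w zero    = sym (trans (ℤP.+-identityˡ (w zero * 1ℤ)) (ℤP.*-identityʳ (w zero)))
clearColumn-split         zero    w (suc c) = sym (trans (cong₂ _+_ (ℤP.*-identityˡ (w (suc c))) (ℤP.*-zeroʳ (w zero))) (ℤP.+-identityʳ (w (suc c))))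
clearColumn-split {suc n} (suc j) w zero    = sym (trans (cong₂ _+_ (ℤP.*-identityˡ (w zero)) (ℤP.*-zeroʳ (w (suc j)))) (ℤP.+-identityʳ (w zero)))
clearColumn-split {suc n} (suc j) w (suc c) = clearColumn-split j (tail w) c

insertAt-cong : ∀ {u v : Vector ℤ n} j x → u ≗ v → insertAt u j x ≗ insertAt v j x
insertAt-cong         zero    x u≗v zero    = refl
insertAt-cong         zero    x u≗v (suc c) = u≗v c
insertAt-cong {suc n} (suc j) x u≗v zero    = u≗v zero
insertAt-cong {suc n} (suc j) x u≗v (suc c) = insertAt-cong j x (u≗v ∘ suc) c

insertAt-linear : ∀ (u v : Vector ℤ n) j α β →
                  insertAt (λ k → α * u k + β * v k) j 0ℤ ≗ λ c → α * insertAt u j 0ℤ c + β * insertAt v j 0ℤ c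
insertAt-linear         u v zero    α β zero    = sym (trans (cong₂ _+_ (ℤP.*-zeroʳ α) (ℤP.*-zeroʳ β)) refl)
insertAt-linear         u v zero    α β (suc c) = refl
insertAt-linear {suc n} u v (suc j) α β zero    = refl
insertAt-linear {suc n} u v (suc j) α β (suc c) = insertAt-linear (u ∘ suc) (v ∘ suc) j α β c

insertAt-1ₘ : ∀ (j : Fin (suc n)) r → insertAt (1ₘ r) j 0ℤ ≗ 1ₘ (punchIn j r)
insertAt-1ₘ         zero    r       zero    = refl
insertAt-1ₘ         zero    r       (suc c) = refl
insertAt-1ₘ {suc n} (suc j) zero    zero    = refl
insertAt-1ₘ {suc n} (suc j) (suc r) zero    = refl
insertAt-1ₘ {suc n} (suc j) zero    (suc c) = insertAt-0 j c
  where insertAt-0 : ∀ {n} (j : Fin (suc n)) → insertAt (λ _ → 0ℤ) j 0ℤ ≗ λ _ → 0ℤ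
        insertAt-0         zero    zero    = refl
        insertAt-0         zero    (suc c) = refl
        insertAt-0 {suc n} (suc j) zero    = refl
        insertAt-0 {suc n} (suc j) (suc c) = insertAt-0 j c
insertAt-1ₘ {suc n} (suc j) (suc r) (suc c) = insertAt-1ₘ j r c

-- With row 0 equal to e_j, column j can be cleared from the other rows; what is left is an
-- alternating multilinear form of the minor, to which the uniqueness for size n applies.
row₀-unit-expansion : ∀ {f : Matrix (suc n) (suc n) → ℤ} → IsAlternatingMultilinear f →
                      (∀ {g : Matrix n n → ℤ} → IsAlternatingMultilinear g → ∀ Y → g Y ≡ det Y * g 1ₘ) →
                      ∀ X j → f (X [ zero ]≔ 1ₘ j) ≡ det (minor j X) * (sgn j * f 1ₘ)
row₀-unit-expansion {n} {f} am unique X j = begin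
  f (X [ zero ]≔ 1ₘ j)              ≡⟨ cong-≋ (λ { zero c → refl ; (suc r) c → refl }) ⟩
  F (tail X)                        ≡⟨ map-rows-invariant F.cong-≋ (clearColumn j) F-clear (tail X) ⟨
  G (minor j X)                     ≡⟨ unique G-am (minor j X) ⟩
  det (minor j X) * G 1ₘ            ≡⟨ cong (det (minor j X) *_) (trans (cong-≋ G1≋toTop) (toTop-sign am j 1ₘ)) ⟩
  det (minor j X) * (sgn j * f 1ₘ)  ∎
  where
  open ≡-Reasoning
  open IsAlternatingMultilinear am
  F : Matrix n (suc n) → ℤ
  F Z = f (1ₘ j ∷ Z)
  F-am = ∷-isAlternatingMultilinear am (1ₘ j)
  module F = IsAlternatingMultilinear F-am
  G : Matrix n n → ℤ
  G Y = F (map (λ y → insertAt y j 0ℤ) Y)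
  G-am : IsAlternatingMultilinear G
  G-am = map-isAlternatingMultilinear F-am (λ y → insertAt y j 0ℤ) (insertAt-cong j 0ℤ)
                                      (λ u v α β → insertAt-linear u v j α β)
  G1≋toTop : 1ₘ j ∷ map (λ y → insertAt y j 0ℤ) 1ₘ ≋ toTop j 1ₘ
  G1≋toTop zero    c = refl
  G1≋toTop (suc r) c = insertAt-1ₘ j r c
  F-clear : ∀ Z i → F (Z [ i ]≔ clearColumn j (Z i)) ≡ F Z
  F-clear Z i = sym (begin
    F Z
      ≡⟨ F.cong-≋ (λ r c → trans (sym (≔-self Z i r c)) (≔-cong Z i (clearColumn-split j (Z i)) r c)) ⟩
    F (Z [ i ]≔ λ c → 1ℤ * clearColumn j (Z i) c + Z i j * 1ₘ j c)  ≡⟨ F.linear Z i (clearColumn j (Z i)) (1ₘ j) 1ℤ (Z i j) ⟩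
    1ℤ * F (Z [ i ]≔ clearColumn j (Z i)) + Z i j * F (Z [ i ]≔ 1ₘ j)
      ≡⟨ cong (λ y → 1ℤ * F (Z [ i ]≔ clearColumn j (Z i)) + Z i j * y)
              (alternating (1ₘ j ∷ (Z [ i ]≔ 1ₘ j)) {zero} {suc i} (λ ()) (λ c → sym (cong-app (updateAt-updates i Z) c))) ⟩
    1ℤ * F (Z [ i ]≔ clearColumn j (Z i)) + Z i j * 0ℤ
      ≡⟨ cong₂ _+_ (ℤP.*-identityˡ (F (Z [ i ]≔ clearColumn j (Z i)))) (ℤP.*-zeroʳ (Z i j)) ⟩
    F (Z [ i ]≔ clearColumn j (Z i)) + 0ℤ                           ≡⟨ ℤP.+-identityʳ _ ⟩
    F (Z [ i ]≔ clearColumn j (Z i))                                ∎)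

det-unique : ∀ {f : Matrix n n → ℤ} → IsAlternatingMultilinear f → ∀ X → f X ≡ det X * f 1ₘ
det-unique {zero}  {f} am X = trans (cong-≋ λ ()) (sym (ℤP.*-identityˡ (f 1ₘ)))
  where open IsAlternatingMultilinear am
det-unique {suc n} {f} am X = begin
  f X                                                            ≡⟨ cong-≋ row₀-in-unit-rows ⟩
  f (X [ zero ]≔ λ c → ∑[ j < suc n ] (X zero j * 1ₘ j c))       ≡⟨ linear-∑ X zero (X zero) 1ₘ ⟩
  ∑[ j < suc n ] (X zero j * f (X [ zero ]≔ 1ₘ j))               ≡⟨ sum-cong-≗ (λ j → cong (X zero j *_) (row₀-unit-expansion am det-unique X j)) ⟩
  ∑[ j < suc n ] (X zero j * (det (minor j X) * (sgn j * f 1ₘ))) ≡⟨ sum-cong-≗ (λ j → regroup (X zero j) (det (minor j X)) (sgn j) (f 1ₘ)) ⟩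
  ∑[ j < suc n ] (laplaceTerm X j * f 1ₘ)                        ≡⟨ *-distribʳ-sum (f 1ₘ) (laplaceTerm X) ⟨
  sum (laplaceTerm X) * f 1ₘ                                     ≡⟨ cong (_* f 1ₘ) (det-expand X) ⟨
  det X * f 1ₘ                                                   ∎
  where
  open ≡-Reasoning
  open IsAlternatingMultilinear am
  regroup : ∀ x D s F → x * (D * (s * F)) ≡ s * (x * D) * F
  regroup = solve-∀
  row₀-in-unit-rows : X ≋ X [ zero ]≔ λ c → ∑[ j < suc n ] (X zero j * 1ₘ j c)
  row₀-in-unit-rows zero    c = sym (trans (∑-scalarʳ 1ℤ c (X zero)) (ℤP.*-identityʳ (X zero c)))
  row₀-in-unit-rows (suc r) c = refl

infixl 7 _*ₘ_
infixl 6 _+ₘ_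
infix  8 -ₘ_

_*ₘ_ : Matrix a b → Matrix b c → Matrix a c
(A *ₘ B) i j = sum λ k → A i k * B k j

_+ₘ_ : Matrix m n → Matrix m n → Matrix m n
(A +ₘ B) i j = A i j + B i j

-ₘ_ : Matrix m n → Matrix m n
(-ₘ A) i j = - A i j

0ₘ : Matrix m n
0ₘ _ _ = 0ℤ

_ᵀ : Matrix m n → Matrix n m
(A ᵀ) i j = A j i

charMatrix : ℤ → Matrix n n → Matrix n n
charMatrix x A i j = scalar x i j - A i j

*ₘ-identityˡ : (A : Matrix m n) → 1ₘ *ₘ A ≋ A
*ₘ-identityˡ A i j = trans (∑-scalarˡ 1ℤ i (λ k → A k j)) (ℤP.*-identityˡ (A i j))

*ₘ-identityʳ : (A : Matrix m n) → A *ₘ 1ₘ ≋ A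
*ₘ-identityʳ A i j = trans (∑-scalarʳ 1ℤ j (A i)) (ℤP.*-identityʳ (A i j))

*ₘ-zeroˡ : (A : Matrix m n) → 0ₘ {a} *ₘ A ≋ 0ₘ
*ₘ-zeroˡ A i j = ∑-zero (λ k → 0ℤ * A k j) (λ _ → refl)

*ₘ-zeroʳ : (A : Matrix m n) → A *ₘ 0ₘ {n} {a} ≋ 0ₘ
*ₘ-zeroʳ A i j = ∑-zero (λ k → A i k * 0ℤ) (λ k → ℤP.*-zeroʳ (A i k))

scalar-*ₘ : ∀ x (A : Matrix m n) → scalar x *ₘ A ≋ λ i j → x * A i j
scalar-*ₘ x A i j = ∑-scalarˡ x i (λ k → A k j)

*ₘ-scalar : ∀ x (A : Matrix m n) → A *ₘ scalar x ≋ λ i j → A i j * x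
*ₘ-scalar x A i j = ∑-scalarʳ x j (A i)

*ₘ-negʳ : (A : Matrix m n) (B : Matrix n a) → A *ₘ (-ₘ B) ≋ -ₘ (A *ₘ B)
*ₘ-negʳ A B i j = trans (sum-cong-≗ λ k → sym (ℤP.neg-distribʳ-* (A i k) (B k j))) (∑-neg (λ k → A i k * B k j))

det-*ₘ : (A B : Matrix n n) → det (A *ₘ B) ≡ det A * det B
det-*ₘ {n} A B = trans (det-unique am A) (cong (det A *_) (det-cong (*ₘ-identityˡ B)))
  where
  ψ : Vector ℤ n → Vector ℤ n
  ψ u j = sum λ k → u k * B k j
  distrib : ∀ α β x y z → (α * x + β * y) * z ≡ α * (x * z) + β * (y * z)
  distrib = solve-∀
  am = map-isAlternatingMultilinear det-isAlternatingMultilinear ψ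
         (λ u≗v j → sum-cong-≗ λ k → cong (_* B k j) (u≗v k))
         (λ u v α β j → trans (sum-cong-≗ λ k → distrib α β (u k) (v k) (B k j))
                              (∑-linear α β (λ k → u k * B k j) (λ k → v k * B k j)))

det-scalar : ∀ x → det (scalar {n} x) ≡ x ^ n
det-scalar {zero}  x = refl
det-scalar {suc n} x = begin
  det (scalar {suc n} x)                                           ≡⟨ det-expand (scalar {suc n} x) ⟩
  1ℤ * (x * det (scalar {n} x)) + ∑[ k < n ] (sgn (suc k) * 0ℤ)
    ≡⟨ cong₂ _+_ (ℤP.*-identityˡ (x * det (scalar {n} x))) (∑-zero (λ (k : Fin n) → sgn (suc k) * 0ℤ) λ k → ℤP.*-zeroʳ (sgn (suc k))) ⟩
  x * det (scalar {n} x) + 0ℤ                                      ≡⟨ ℤP.+-identityʳ _ ⟩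
  x * det (scalar {n} x)                                           ≡⟨ cong (x *_) (det-scalar {n} x) ⟩
  x ^ suc n                                                        ∎
  where open ≡-Reasoning

det-1ₘ : det (1ₘ {n}) ≡ 1ℤ
det-1ₘ {n} = trans (det-scalar {n} 1ℤ) (ℤP.^-zeroˡ n)

det-zero-column₀ : (X : Matrix (suc n) (suc n)) → (∀ r → X r zero ≡ 0ℤ) → det X ≡ 0ℤ
det-zero-column₀ {zero}  X col = cong (λ x → 1ℤ * (x * 1ℤ) + 0ℤ) (col zero)
det-zero-column₀ {suc n} X col = trans (det-expand X) (∑-zero (laplaceTerm X) term)
  where
  term : ∀ j → laplaceTerm X j ≡ 0ℤ
  term zero    = cong (λ x → 1ℤ * (x * det (minor zero X))) (col zero)
  term (suc j) = trans (cong (λ D → sgn (suc j) * (X zero (suc j) * D)) (det-zero-column₀ (minor (suc j) X) (col ∘ suc)))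
                       (trans (cong (sgn (suc j) *_) (ℤP.*-zeroʳ (X zero (suc j)))) (ℤP.*-zeroʳ (sgn (suc j))))

det-column₀-unit : (X : Matrix (suc n) (suc n)) → X zero zero ≡ 1ℤ → (∀ r → X (suc r) zero ≡ 0ℤ) →
                   det X ≡ det (minor zero X)
det-column₀-unit {zero}  X one col = cong (λ x → 1ℤ * (x * 1ℤ) + 0ℤ) one
det-column₀-unit {suc n} X one col = begin
  det X                                                                    ≡⟨ det-expand X ⟩
  1ℤ * (X zero zero * det (minor zero X)) + ∑[ k < suc n ] laplaceTerm X (suc k)
    ≡⟨ cong₂ _+_ first (∑-zero (laplaceTerm X ∘ suc) rest) ⟩
  det (minor zero X) + 0ℤ                                                  ≡⟨ ℤP.+-identityʳ _ ⟩
  det (minor zero X)                                                       ∎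
  where
  open ≡-Reasoning
  first : 1ℤ * (X zero zero * det (minor zero X)) ≡ det (minor zero X)
  first = trans (ℤP.*-identityˡ _) (trans (cong (_* det (minor zero X)) one) (ℤP.*-identityˡ _))
  rest : ∀ k → laplaceTerm X (suc k) ≡ 0ℤ
  rest k = trans (cong (λ D → sgn (suc k) * (X zero (suc k) * D)) (det-zero-column₀ (minor (suc k) X) col))
                 (trans (cong (sgn (suc k) *_) (ℤP.*-zeroʳ (X zero (suc k)))) (ℤP.*-zeroʳ (sgn (suc k))))

block : Matrix a c → Matrix a d → Matrix b c → Matrix b d → Matrix (a ℕ.+ b) (c ℕ.+ d)
block A B C D = (λ i → A i ++ B i) ++ (λ i → C i ++ D i)

module _ (A : Matrix a c) (B : Matrix a d) (C : Matrix b c) (D : Matrix b d) where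

  block-↑ˡ↑ˡ : ∀ i j → block A B C D (i ↑ˡ b) (j ↑ˡ d) ≡ A i j
  block-↑ˡ↑ˡ i j = trans (cong-app (lookup-++ˡ _ (λ i → C i ++ D i) i) (j ↑ˡ d)) (lookup-++ˡ (A i) (B i) j)

  block-↑ˡ↑ʳ : ∀ i j → block A B C D (i ↑ˡ b) (c ↑ʳ j) ≡ B i j
  block-↑ˡ↑ʳ i j = trans (cong-app (lookup-++ˡ _ (λ i → C i ++ D i) i) (c ↑ʳ j)) (lookup-++ʳ (A i) (B i) j)

  block-↑ʳ↑ˡ : ∀ i j → block A B C D (a ↑ʳ i) (j ↑ˡ d) ≡ C i j
  block-↑ʳ↑ˡ i j = trans (cong-app (lookup-++ʳ (λ i → A i ++ B i) _ i) (j ↑ˡ d)) (lookup-++ˡ (C i) (D i) j)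

  block-↑ʳ↑ʳ : ∀ i j → block A B C D (a ↑ʳ i) (c ↑ʳ j) ≡ D i j
  block-↑ʳ↑ʳ i j = trans (cong-app (lookup-++ʳ (λ i → A i ++ B i) _ i) (c ↑ʳ j)) (lookup-++ʳ (C i) (D i) j)

+-elim : ∀ {a b} {P : Fin (a ℕ.+ b) → Set} → (∀ i → P (i ↑ˡ b)) → (∀ j → P (a ↑ʳ j)) → ∀ k → P k
+-elim {zero}          left right k       = right k
+-elim {suc a}         left right zero    = left zero
+-elim {suc a} {P = P} left right (suc k) = +-elim {P = P ∘ suc} (λ i → left (suc i)) right k

∑-+ : ∀ {a b} (f : Fin (a ℕ.+ b) → ℤ) → sum f ≡ sum (λ i → f (i ↑ˡ b)) + sum (λ j → f (a ↑ʳ j))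
∑-+ {zero}      f = sym (ℤP.+-identityˡ (sum f))
∑-+ {suc a} {b} f = trans (cong (_+_ (f zero)) (∑-+ {a} {b} (f ∘ suc)))
                          (sym (ℤP.+-assoc (f zero) (sum λ i → f (suc (i ↑ˡ b))) (sum λ j → f (suc (a ↑ʳ j)))))

≋-block : ∀ {X : Matrix (a ℕ.+ b) (c ℕ.+ d)} {A B C D} →
          (∀ i j → X (i ↑ˡ b) (j ↑ˡ d) ≡ A i j) → (∀ i j → X (i ↑ˡ b) (c ↑ʳ j) ≡ B i j) →
          (∀ i j → X (a ↑ʳ i) (j ↑ˡ d) ≡ C i j) → (∀ i j → X (a ↑ʳ i) (c ↑ʳ j) ≡ D i j) →
          X ≋ block A B C D
≋-block {A = A} {B} {C} {D} ll lr rl rr =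
  +-elim (λ i → +-elim (λ j → trans (ll i j) (sym (block-↑ˡ↑ˡ A B C D i j)))
                       (λ j → trans (lr i j) (sym (block-↑ˡ↑ʳ A B C D i j))))
         (λ i → +-elim (λ j → trans (rl i j) (sym (block-↑ʳ↑ˡ A B C D i j)))
                       (λ j → trans (rr i j) (sym (block-↑ʳ↑ʳ A B C D i j))))

block-cong : ∀ {A A′ : Matrix a c} {B B′ : Matrix a d} {C C′ : Matrix b c} {D D′ : Matrix b d} →
             A ≋ A′ → B ≋ B′ → C ≋ C′ → D ≋ D′ → block A B C D ≋ block A′ B′ C′ D′
block-cong {A = A} {B = B} {C = C} {D = D} A≋A′ B≋B′ C≋C′ D≋D′ =
  ≋-block (λ i j → trans (block-↑ˡ↑ˡ A B C D i j) (A≋A′ i j)) (λ i j → trans (block-↑ˡ↑ʳ A B C D i j) (B≋B′ i j))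
          (λ i j → trans (block-↑ʳ↑ˡ A B C D i j) (C≋C′ i j)) (λ i j → trans (block-↑ʳ↑ʳ A B C D i j) (D≋D′ i j))

block-*ₘ : ∀ {a b c d m n} (A : Matrix a c) (B : Matrix a d) (C : Matrix b c) (D : Matrix b d)
             (A′ : Matrix c m) (B′ : Matrix c n) (C′ : Matrix d m) (D′ : Matrix d n) →
           block A B C D *ₘ block A′ B′ C′ D′ ≋
           block (A *ₘ A′ +ₘ B *ₘ C′) (A *ₘ B′ +ₘ B *ₘ D′) (C *ₘ A′ +ₘ D *ₘ C′) (C *ₘ B′ +ₘ D *ₘ D′)
block-*ₘ {a} {b} {c} {d} {m} {n} A B C D A′ B′ C′ D′ =
  ≋-block (λ i j → entry (i ↑ˡ b) (j ↑ˡ n) (block-↑ˡ↑ˡ A B C D i) (λ k → block-↑ˡ↑ˡ A′ B′ C′ D′ k j)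
                                            (block-↑ˡ↑ʳ A B C D i) (λ l → block-↑ʳ↑ˡ A′ B′ C′ D′ l j))
          (λ i j → entry (i ↑ˡ b) (m ↑ʳ j) (block-↑ˡ↑ˡ A B C D i) (λ k → block-↑ˡ↑ʳ A′ B′ C′ D′ k j)
                                            (block-↑ˡ↑ʳ A B C D i) (λ l → block-↑ʳ↑ʳ A′ B′ C′ D′ l j))
          (λ i j → entry (a ↑ʳ i) (j ↑ˡ n) (block-↑ʳ↑ˡ A B C D i) (λ k → block-↑ˡ↑ˡ A′ B′ C′ D′ k j)
                                            (block-↑ʳ↑ʳ A B C D i) (λ l → block-↑ʳ↑ˡ A′ B′ C′ D′ l j))
          (λ i j → entry (a ↑ʳ i) (m ↑ʳ j) (block-↑ʳ↑ˡ A B C D i) (λ k → block-↑ˡ↑ʳ A′ B′ C′ D′ k j)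
                                            (block-↑ʳ↑ʳ A B C D i) (λ l → block-↑ʳ↑ʳ A′ B′ C′ D′ l j))
  where
  X = block A B C D
  Y = block A′ B′ C′ D′
  entry : ∀ {P Q : Fin c → ℤ} {R S : Fin d → ℤ} r s → (∀ k → X r (k ↑ˡ d) ≡ P k) → (∀ k → Y (k ↑ˡ d) s ≡ Q k) →
          (∀ l → X r (c ↑ʳ l) ≡ R l) → (∀ l → Y (c ↑ʳ l) s ≡ S l) →
          (X *ₘ Y) r s ≡ sum (λ k → P k * Q k) + sum (λ l → R l * S l)
  entry r s eP eQ eR eS = trans (∑-+ {c} {d} (λ k → X r k * Y k s))
    (cong₂ _+_ (sum-cong-≗ λ k → cong₂ _*_ (eP k) (eQ k)) (sum-cong-≗ λ l → cong₂ _*_ (eR l) (eS l)))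

sgn-↑ˡ : ∀ {a} b (j : Fin a) → sgn (j ↑ˡ b) ≡ sgn j
sgn-↑ˡ b j = cong sign (toℕ'-↑ˡ j)
  where toℕ'-↑ˡ : ∀ {a} (j : Fin a) → toℕ' (j ↑ˡ b) ≡ toℕ' j
        toℕ'-↑ˡ zero    = refl
        toℕ'-↑ˡ (suc j) = cong suc (toℕ'-↑ˡ j)

punchIn-↑ˡ : ∀ {a} b (j : Fin (suc a)) (k : Fin a) → punchIn (j ↑ˡ b) (k ↑ˡ b) ≡ punchIn j k ↑ˡ b
punchIn-↑ˡ b zero    k       = refl
punchIn-↑ˡ b (suc j) zero    = refl
punchIn-↑ˡ b (suc j) (suc k) = cong suc (punchIn-↑ˡ b j k)

punchIn-↑ʳ : ∀ {a} b (j : Fin (suc a)) (l : Fin b) → punchIn (j ↑ˡ b) (a ↑ʳ l) ≡ suc a ↑ʳ l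
punchIn-↑ʳ         b zero    l = refl
punchIn-↑ʳ {suc a} b (suc j) l = cong suc (punchIn-↑ʳ b j l)

det-block-lower : ∀ {a b} (C : Matrix a a) (Y : Matrix b a) (D : Matrix b b) → det (block C 0ₘ Y D) ≡ det C * det D
det-block-lower {zero}      C Y D = sym (ℤP.*-identityˡ (det D))
det-block-lower {suc a} {b} C Y D = begin
  det X                                                                ≡⟨ det-expand X ⟩
  sum (laplaceTerm X)                                                  ≡⟨ ∑-+ {suc a} {b} (laplaceTerm X) ⟩
  sum (λ j → laplaceTerm X (j ↑ˡ b)) + sum (λ l → laplaceTerm X (suc a ↑ʳ l))
    ≡⟨ cong₂ _+_ (sum-cong-≗ left) (∑-zero (λ l → laplaceTerm X (suc a ↑ʳ l)) right) ⟩
  sum (λ j → laplaceTerm C j * det D) + 0ℤ                             ≡⟨ ℤP.+-identityʳ _ ⟩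
  sum (λ j → laplaceTerm C j * det D)                                  ≡⟨ *-distribʳ-sum (det D) (laplaceTerm C) ⟨
  sum (laplaceTerm C) * det D                                          ≡⟨ cong (_* det D) (det-expand C) ⟨
  det C * det D                                                        ∎
  where
  open ≡-Reasoning
  X = block C 0ₘ Y D
  minor-block : ∀ j → minor (j ↑ˡ b) X ≋ block (minor j C) 0ₘ (λ p k → Y p (punchIn j k)) D
  minor-block j = ≋-block
    (λ i k → trans (cong (X (suc i ↑ˡ b)) (punchIn-↑ˡ b j k)) (block-↑ˡ↑ˡ C 0ₘ Y D (suc i) (punchIn j k)))
    (λ i l → trans (cong (X (suc i ↑ˡ b)) (punchIn-↑ʳ b j l)) (block-↑ˡ↑ʳ C 0ₘ Y D (suc i) l))
    (λ p k → trans (cong (X (suc a ↑ʳ p)) (punchIn-↑ˡ b j k)) (block-↑ʳ↑ˡ C 0ₘ Y D p (punchIn j k)))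
    (λ p l → trans (cong (X (suc a ↑ʳ p)) (punchIn-↑ʳ b j l)) (block-↑ʳ↑ʳ C 0ₘ Y D p l))
  regroup : ∀ s x M D → s * (x * (M * D)) ≡ s * (x * M) * D
  regroup = solve-∀
  left : ∀ j → laplaceTerm X (j ↑ˡ b) ≡ laplaceTerm C j * det D
  left j = trans (cong₂ (λ s y → s * y) (sgn-↑ˡ b j)
                   (cong₂ _*_ (block-↑ˡ↑ˡ C 0ₘ Y D zero j)
                              (trans (det-cong (minor-block j)) (det-block-lower (minor j C) _ D))))
                 (regroup (sgn j) (C zero j) (det (minor j C)) (det D))
  right : ∀ l → laplaceTerm X (suc a ↑ʳ l) ≡ 0ℤ
  right l = trans (cong (λ x → sgn (suc a ↑ʳ l) * (x * det (minor (suc a ↑ʳ l) X))) (block-↑ˡ↑ʳ C 0ₘ Y D zero l))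
                  (ℤP.*-zeroʳ (sgn (suc a ↑ʳ l)))

det-block-upper-1ₘ : ∀ {a b} (B : Matrix a b) (D : Matrix b b) → det (block 1ₘ B 0ₘ D) ≡ det D
det-block-upper-1ₘ {zero}      B D = refl
det-block-upper-1ₘ {suc a} {b} B D = begin
  det X                          ≡⟨ det-column₀-unit X (block-↑ˡ↑ˡ 1ₘ B 0ₘ D zero zero) column₀ ⟩
  det (minor zero X)             ≡⟨ det-cong minor₀ ⟩
  det (block 1ₘ (B ∘ suc) 0ₘ D)  ≡⟨ det-block-upper-1ₘ (B ∘ suc) D ⟩
  det D                          ∎
  where
  open ≡-Reasoning
  X = block 1ₘ B 0ₘ D
  column₀ : ∀ r → X (suc r) zero ≡ 0ℤ
  column₀ = +-elim (λ i → block-↑ˡ↑ˡ 1ₘ B 0ₘ D (suc i) zero) (λ p → block-↑ʳ↑ˡ 1ₘ B 0ₘ D p zero)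
  minor₀ : minor zero X ≋ block 1ₘ (B ∘ suc) 0ₘ D
  minor₀ = ≋-block (λ i j → block-↑ˡ↑ˡ 1ₘ B 0ₘ D (suc i) (suc j)) (λ i j → block-↑ˡ↑ʳ 1ₘ B 0ₘ D (suc i) j)
                   (λ p j → block-↑ʳ↑ˡ 1ₘ B 0ₘ D p (suc j)) (λ p j → block-↑ʳ↑ʳ 1ₘ B 0ₘ D p j)

-- [[x, A], [B, 1]] = [[1, A], [0, 1]] · [[x - AB, 0], [B, 1]]
det-block-scalar-1ₘ : ∀ (A B : Matrix n n) x → det (block (scalar x) A B 1ₘ) ≡ charPolyAt (A *ₘ B) x
det-block-scalar-1ₘ {n} A B x = begin
  det (block (scalar x) A B 1ₘ)                          ≡⟨ det-cong UK≋T ⟨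
  det (U *ₘ K)                                           ≡⟨ det-*ₘ U K ⟩
  det U * det K                                          ≡⟨ cong₂ _*_ (det-block-upper-1ₘ A 1ₘ) (det-block-lower (charMatrix x (A *ₘ B)) B 1ₘ) ⟩
  det (1ₘ {n}) * (charPolyAt (A *ₘ B) x * det (1ₘ {n}))  ≡⟨ cong₂ (λ u v → u * (charPolyAt (A *ₘ B) x * v)) (det-1ₘ {n}) (det-1ₘ {n}) ⟩
  1ℤ * (charPolyAt (A *ₘ B) x * 1ℤ)                      ≡⟨ trans (ℤP.*-identityˡ _) (ℤP.*-identityʳ _) ⟩
  charPolyAt (A *ₘ B) x                                  ∎
  where
  open ≡-Reasoning
  U = block 1ₘ A 0ₘ 1ₘ
  K = block (charMatrix x (A *ₘ B)) 0ₘ B 1ₘ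
  cancel-sub : ∀ s m → s - m + m ≡ s
  cancel-sub = solve-∀
  UK≋T : U *ₘ K ≋ block (scalar x) A B 1ₘ
  UK≋T i j = trans (block-*ₘ 1ₘ A 0ₘ 1ₘ (charMatrix x (A *ₘ B)) 0ₘ B 1ₘ i j) (block-cong
    (λ i j → trans (cong (_+ (A *ₘ B) i j) (*ₘ-identityˡ (charMatrix x (A *ₘ B)) i j)) (cancel-sub (scalar x i j) ((A *ₘ B) i j)))
    (λ i j → trans (cong₂ _+_ (*ₘ-zeroʳ 1ₘ i j) (*ₘ-identityʳ A i j)) (ℤP.+-identityˡ (A i j)))
    (λ i j → trans (cong₂ _+_ (*ₘ-zeroˡ (charMatrix x (A *ₘ B)) i j) (*ₘ-identityˡ B i j)) (ℤP.+-identityˡ (B i j)))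
    (λ i j → trans (cong₂ _+_ (*ₘ-zeroˡ (0ₘ {n} {n}) i j) (*ₘ-identityˡ 1ₘ i j)) (ℤP.+-identityˡ (1ₘ i j)))
    i j)

-- [[x, A], [B, 1]] · [[1, -A], [0, x]] = [[x, 0], [B, x - BA]]
x^n*charPolyAt-*ₘ-comm : ∀ (A B : Matrix n n) x → x ^ n * charPolyAt (A *ₘ B) x ≡ x ^ n * charPolyAt (B *ₘ A) x
x^n*charPolyAt-*ₘ-comm {n} A B x = begin
  x ^ n * charPolyAt (A *ₘ B) x                  ≡⟨ cong₂ _*_ (sym det-R) (sym (det-block-scalar-1ₘ A B x)) ⟩
  det R * det T                                  ≡⟨ ℤP.*-comm (det R) (det T) ⟩
  det T * det R                                  ≡⟨ det-*ₘ T R ⟨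
  det (T *ₘ R)                                   ≡⟨ det-cong TR≋V ⟩
  det V                                          ≡⟨ det-block-lower (scalar x) B (charMatrix x (B *ₘ A)) ⟩
  det (scalar {n} x) * charPolyAt (B *ₘ A) x     ≡⟨ cong (_* charPolyAt (B *ₘ A) x) (det-scalar {n} x) ⟩
  x ^ n * charPolyAt (B *ₘ A) x                  ∎
  where
  open ≡-Reasoning
  T = block (scalar {n} x) A B 1ₘ
  R = block 1ₘ (-ₘ A) 0ₘ (scalar {n} x)
  V = block (scalar {n} x) 0ₘ B (charMatrix x (B *ₘ A))
  cancel-mul : ∀ x a → x * - a + a * x ≡ 0ℤ
  cancel-mul = solve-∀
  neg-add : ∀ m s → - m + s ≡ s - m
  neg-add = solve-∀
  TR≋V : T *ₘ R ≋ V
  TR≋V i j = trans (block-*ₘ (scalar {n} x) A B 1ₘ 1ₘ (-ₘ A) 0ₘ (scalar {n} x) i j) (block-cong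
    (λ i j → trans (cong₂ _+_ (*ₘ-identityʳ (scalar x) i j) (*ₘ-zeroʳ A i j)) (ℤP.+-identityʳ (scalar x i j)))
    (λ i j → trans (cong₂ _+_ (scalar-*ₘ x (-ₘ A) i j) (*ₘ-scalar {n} x A i j)) (cancel-mul x (A i j)))
    (λ i j → trans (cong₂ _+_ (*ₘ-identityʳ B i j) (*ₘ-zeroʳ 1ₘ i j)) (ℤP.+-identityʳ (B i j)))
    (λ i j → trans (cong₂ _+_ (*ₘ-negʳ B A i j) (*ₘ-identityˡ (scalar {n} x) i j)) (neg-add ((B *ₘ A) i j) (scalar x i j)))
    i j)
  det-R : det R ≡ x ^ n
  det-R = trans (det-block-upper-1ₘ (-ₘ A) (scalar x)) (det-scalar {n} x)

scalar-0 : (i j : Fin n) → scalar 0ℤ i j ≡ 0ℤ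
scalar-0 i j with does (i ≟ j)
... | true  = refl
... | false = refl

charPolyAt-*ₘ-0ℤ : ∀ (A B : Matrix n n) → charPolyAt (A *ₘ B) 0ℤ ≡ det (scalar {n} -1ℤ) * (det A * det B)
charPolyAt-*ₘ-0ℤ {n} A B = begin
  det (charMatrix 0ℤ (A *ₘ B))         ≡⟨ det-cong entries ⟩
  det (scalar {n} -1ℤ *ₘ (A *ₘ B))         ≡⟨ det-*ₘ (scalar {n} -1ℤ) (A *ₘ B) ⟩
  det (scalar {n} -1ℤ) * det (A *ₘ B)      ≡⟨ cong (det (scalar {n} -1ℤ) *_) (det-*ₘ A B) ⟩
  det (scalar {n} -1ℤ) * (det A * det B)   ∎
  where
  open ≡-Reasoning
  entries : charMatrix 0ℤ (A *ₘ B) ≋ scalar {n} -1ℤ *ₘ (A *ₘ B)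
  entries i j = trans (cong (_- (A *ₘ B) i j) (scalar-0 i j))
                      (trans (ℤP.+-identityˡ (- (A *ₘ B) i j))
                      (trans (sym (ℤP.-1*i≡-i ((A *ₘ B) i j))) (sym (scalar-*ₘ -1ℤ (A *ₘ B) i j))))

charPolyAt-*ₘ-comm : ∀ (A B : Matrix n n) x → charPolyAt (A *ₘ B) x ≡ charPolyAt (B *ₘ A) x
charPolyAt-*ₘ-comm {n} A B x with x ℤ.≟ 0ℤ
... | yes refl = trans (charPolyAt-*ₘ-0ℤ A B)
                       (trans (cong (det (scalar {n} -1ℤ) *_) (ℤP.*-comm (det A) (det B))) (sym (charPolyAt-*ₘ-0ℤ B A)))
... | no x≢0   = ℤP.*-cancelˡ-≡ (x ^ n) _ _ {{≢-nonZero (x≢0 ∘ ℤP.i^n≡0⇒i≡0 x n)}} (x^n*charPolyAt-*ₘ-comm A B x)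

scalar-↑ˡ↑ˡ : ∀ {a b} x (i j : Fin a) → scalar {a ℕ.+ b} x (i ↑ˡ b) (j ↑ˡ b) ≡ scalar x i j
scalar-↑ˡ↑ˡ x zero    zero    = refl
scalar-↑ˡ↑ˡ x zero    (suc j) = refl
scalar-↑ˡ↑ˡ x (suc i) zero    = refl
scalar-↑ˡ↑ˡ x (suc i) (suc j) = scalar-↑ˡ↑ˡ x i j

scalar-↑ˡ↑ʳ : ∀ {a b} x (i : Fin a) (j : Fin b) → scalar x (i ↑ˡ b) (a ↑ʳ j) ≡ 0ℤ
scalar-↑ˡ↑ʳ         x zero    j = refl
scalar-↑ˡ↑ʳ {suc a} x (suc i) j = scalar-↑ˡ↑ʳ x i j

scalar-↑ʳ↑ˡ : ∀ {a b} x (i : Fin b) (j : Fin a) → scalar x (a ↑ʳ i) (j ↑ˡ b) ≡ 0ℤ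
scalar-↑ʳ↑ˡ         x i zero    = refl
scalar-↑ʳ↑ˡ {suc a} x i (suc j) = scalar-↑ʳ↑ˡ x i j

scalar-↑ʳ↑ʳ : ∀ {a b} x (i j : Fin b) → scalar x (a ↑ʳ i) (a ↑ʳ j) ≡ scalar x i j
scalar-↑ʳ↑ʳ {zero}  x i j = refl
scalar-↑ʳ↑ʳ {suc a} x i j = scalar-↑ʳ↑ʳ {a} x i j

-- Appending d zero rows to M leaves Mᵀ M unchanged and turns M Mᵀ into diag(M Mᵀ, 0).
charPolyAt-ᵀ*ₘ-padded : ∀ {n d} (M : Matrix n (n ℕ.+ d)) x →
                        charPolyAt (M ᵀ *ₘ M) x ≡ x ^ d * charPolyAt (M *ₘ M ᵀ) x
charPolyAt-ᵀ*ₘ-padded {n} {d} M x = begin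
  charPolyAt (M ᵀ *ₘ M) x                                  ≡⟨ det-cong (λ i j → cong (_-_ (scalar x i j)) (PᵀP≋MᵀM i j)) ⟨
  charPolyAt (P ᵀ *ₘ P) x                                  ≡⟨ charPolyAt-*ₘ-comm (P ᵀ) P x ⟩
  charPolyAt (P *ₘ P ᵀ) x                                  ≡⟨ det-cong PPᵀ-block ⟩
  det (block (charMatrix x (M *ₘ M ᵀ)) 0ₘ 0ₘ (scalar x))   ≡⟨ det-block-lower (charMatrix x (M *ₘ M ᵀ)) 0ₘ (scalar x) ⟩
  charPolyAt (M *ₘ M ᵀ) x * det (scalar {d} x)             ≡⟨ cong (charPolyAt (M *ₘ M ᵀ) x *_) (det-scalar {d} x) ⟩
  charPolyAt (M *ₘ M ᵀ) x * x ^ d                          ≡⟨ ℤP.*-comm (charPolyAt (M *ₘ M ᵀ) x) (x ^ d) ⟩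
  x ^ d * charPolyAt (M *ₘ M ᵀ) x                          ∎
  where
  open ≡-Reasoning
  P : Matrix (n ℕ.+ d) (n ℕ.+ d)
  P = M ++ 0ₘ
  P-↑ˡ : ∀ i c → P (i ↑ˡ d) c ≡ M i c
  P-↑ˡ i = cong-app (lookup-++ˡ M 0ₘ i)
  P-↑ʳ : ∀ l c → P (n ↑ʳ l) c ≡ 0ℤ
  P-↑ʳ l = cong-app (lookup-++ʳ M 0ₘ l)
  PᵀP≋MᵀM : P ᵀ *ₘ P ≋ M ᵀ *ₘ M
  PᵀP≋MᵀM i j = begin
    sum (λ k → P k i * P k j)                                              ≡⟨ ∑-+ {n} {d} (λ k → P k i * P k j) ⟩
    sum (λ k → P (k ↑ˡ d) i * P (k ↑ˡ d) j) + sum (λ l → P (n ↑ʳ l) i * P (n ↑ʳ l) j)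
      ≡⟨ cong₂ _+_ (sum-cong-≗ λ k → cong₂ _*_ (P-↑ˡ k i) (P-↑ˡ k j))
                   (∑-zero (λ l → P (n ↑ʳ l) i * P (n ↑ʳ l) j) λ l → cong (_* P (n ↑ʳ l) j) (P-↑ʳ l i)) ⟩
    sum (λ k → M k i * M k j) + 0ℤ                                         ≡⟨ ℤP.+-identityʳ _ ⟩
    sum (λ k → M k i * M k j)                                              ∎
  PPᵀ-block : charMatrix x (P *ₘ P ᵀ) ≋ block (charMatrix x (M *ₘ M ᵀ)) 0ₘ 0ₘ (scalar x)
  PPᵀ-block = ≋-block
    (λ i j → cong₂ _-_ (scalar-↑ˡ↑ˡ x i j) (sum-cong-≗ λ l → cong₂ _*_ (P-↑ˡ i l) (P-↑ˡ j l)))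
    (λ i j → cong₂ _-_ (scalar-↑ˡ↑ʳ x i j)
                       (∑-zero (λ l → P (i ↑ˡ d) l * P (n ↑ʳ j) l) λ l → trans (cong (P (i ↑ˡ d) l *_) (P-↑ʳ j l)) (ℤP.*-zeroʳ (P (i ↑ˡ d) l))))
    (λ i j → cong₂ _-_ (scalar-↑ʳ↑ˡ x i j)
                       (∑-zero (λ l → P (n ↑ʳ i) l * P (j ↑ˡ d) l) λ l → cong (_* P (j ↑ˡ d) l) (P-↑ʳ i l)))
    (λ i j → trans (cong₂ _-_ (scalar-↑ʳ↑ʳ {n} x i j)
                              (∑-zero (λ l → P (n ↑ʳ i) l * P (n ↑ʳ j) l) λ l → cong (_* P (n ↑ʳ j) l) (P-↑ʳ i l)))
                   (ℤP.+-identityʳ (scalar x i j)))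

charPolyAt-ᵀ*ₘ : ∀ {n N} (M : Matrix n N) x → n ≤ N →
                 charPolyAt (M ᵀ *ₘ M) x ≡ x ^ (N ∸ n) * charPolyAt (M *ₘ M ᵀ) x
charPolyAt-ᵀ*ₘ {n} M x n≤N with ℕP.m≤n⇒∃[o]m+o≡n n≤N
... | d , refl = trans (charPolyAt-ᵀ*ₘ-padded M x)
                       (cong (λ k → x ^ k * charPolyAt (M *ₘ M ᵀ) x) (sym (ℕP.m+n∸m≡n n d)))

charPolyAt-shift : ∀ {A B : Matrix n n} s x → B ≋ A +ₘ scalar s → charPolyAt B x ≡ charPolyAt A (x - s)
charPolyAt-shift {A = A} {B} s x B≋A+s = det-cong λ i j → trans (cong (_-_ (scalar x i j)) (B≋A+s i j)) (entry i j)
  where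
  on-diagonal : ∀ x a s → x - (a + s) ≡ (x - s) - a
  on-diagonal = solve-∀
  off-diagonal : ∀ a → 0ℤ - (a + 0ℤ) ≡ 0ℤ - a
  off-diagonal = solve-∀
  entry : ∀ i j → scalar x i j - (A i j + scalar s i j) ≡ scalar (x - s) i j - A i j
  entry i j with does (i ≟ j)
  ... | true  = on-diagonal x (A i j) s
  ... | false = off-diagonal (A i j)

𝟙 : Bool → ℤ
𝟙 b = if b then 1ℤ else 0ℤ

𝟙-∧ : ∀ b c → 𝟙 b * 𝟙 c ≡ 𝟙 (b ∧ c)
𝟙-∧ true  c = ℤP.*-identityˡ (𝟙 c)
𝟙-∧ false c = refl

𝟙-idem : ∀ b → 𝟙 b * 𝟙 b ≡ 𝟙 b
𝟙-idem true  = refl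
𝟙-idem false = refl

𝟙-pos : ∀ b → + (if b then 1 else 0) ≡ 𝟙 b
𝟙-pos true  = refl
𝟙-pos false = refl

∧-true : ∀ {b c} → b ∧ c ≡ true → b ≡ true × c ≡ true
∧-true {true} {true} refl = refl , refl

∑-𝟙-single : ∀ (f : Fin n → Bool) u → f u ≡ true → (∀ v → f v ≡ true → v ≡ u) → sum (𝟙 ∘ f) ≡ 1ℤ
∑-𝟙-single f u fu unique = trans (sum-cong-≗ pointwise) (∑-scalarˡ 1ℤ u (λ _ → 1ℤ))
  where
  pointwise : ∀ v → 𝟙 (f v) ≡ scalar 1ℤ u v * 1ℤ
  pointwise v with u ≟ v
  ... | yes refl = cong 𝟙 fu
  ... | no u≢v with f v in fv
  ...   | true  = ⊥-elim (u≢v (sym (unique v fv)))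
  ...   | false = refl

∑-𝟙-lookup : (S : Subset n) → sum (λ u → 𝟙 (lookup S u)) ≡ + ∣ S ∣
∑-𝟙-lookup Vec.[]            = refl
∑-𝟙-lookup (true Vec.∷ S)   = trans (cong (_+_ 1ℤ) (∑-𝟙-lookup S)) (sym (ℤP.pos-+ 1 ∣ S ∣))
∑-𝟙-lookup (false Vec.∷ S)  = trans (ℤP.+-identityˡ _) (∑-𝟙-lookup S)

+-sumℕ : (f : Fin n → ℕ) → + sumℕ f ≡ sum (λ i → + f i)
+-sumℕ {zero}  f = refl
+-sumℕ {suc n} f = trans (ℤP.pos-+ (f zero) (sumℕ (f ∘ suc))) (cong (_+_ (+ f zero)) (+-sumℕ (f ∘ suc)))

∑-scalar-row : ∀ x (i : Fin n) → sum (scalar x i) ≡ x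
∑-scalar-row x i = trans (sum-cong-≗ λ k → sym (ℤP.*-identityʳ (scalar x i k)))
                         (trans (∑-scalarˡ x i (λ _ → 1ℤ)) (ℤP.*-identityʳ x))

∑-const : ∀ n x → ∑[ i < n ] x ≡ + n * x
∑-const zero    x = sym (ℤP.*-zeroˡ x)
∑-const (suc n) x = trans (cong (_+_ x) (∑-const n x))
                          (trans (factor x (+ n)) (cong (_* x) (sym (ℤP.pos-+ 1 n))))
  where factor : ∀ x m → x + m * x ≡ (1ℤ + m) * x
        factor = solve-∀

module CliqueIncidence {n ω N} (G : Graph n) (CR : IsCliqueRegular G ω)
                       (e : Fin N → Subset n) (enum : IsCliqueEnumeration G ω N e) where

  incidence : Matrix n N
  incidence u i = 𝟙 (lookup (e i) u)

  cliqueDegree : Fin n → ℕ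
  cliqueDegree u = sumℕ λ i → if lookup (e i) u then 1 else 0

  private
    e-isClique : ∀ i → IsClique G ω (e i)
    e-isClique = proj₁ enum

    clique-adj : ∀ i {u v} → lookup (e i) u ≡ true → lookup (e i) v ≡ true → u ≢ v → adj G u v ≡ true
    clique-adj i u∈ v∈ = proj₂ (e-isClique i) _ _ (lookup⇒[]= _ (e i) u∈) (lookup⇒[]= _ (e i) v∈)

    edge-clique-unique : ∀ {u v} → adj G u v ≡ true → ∀ i j →
                         lookup (e i) u ≡ true → lookup (e i) v ≡ true →
                         lookup (e j) u ≡ true → lookup (e j) v ≡ true → i ≡ j
    edge-clique-unique uv i j ui vi uj vj = proj₁ (proj₂ enum) i j
      (proj₂ (proj₂ CR _ _ uv) (e i) (e j) (e-isClique i) (lookup⇒[]= _ (e i) ui) (lookup⇒[]= _ (e i) vi)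
                                           (e-isClique j) (lookup⇒[]= _ (e j) uj) (lookup⇒[]= _ (e j) vj))

    lookup-∩ : ∀ i j u → lookup (e i ∩ e j) u ≡ lookup (e i) u ∧ lookup (e j) u
    lookup-∩ i j u = lookup-zipWith _∧_ u (e i) (e j)

  ∑-incidence-row : ∀ u → sum (incidence u) ≡ + cliqueDegree u
  ∑-incidence-row u = sym (trans (+-sumℕ λ i → if lookup (e i) u then 1 else 0) (sum-cong-≗ λ i → 𝟙-pos (lookup (e i) u)))

  ∑-incidence-column : ∀ i → sum (λ u → incidence u i) ≡ + ω
  ∑-incidence-column i = trans (∑-𝟙-lookup (e i)) (cong +_ (proj₁ (e-isClique i)))

  -- Two distinct cliques share at most one vertex: two common vertices would be an edge in both.
  incidenceᵀ*incidence : incidence ᵀ *ₘ incidence ≋ cliqueGraphAdj e +ₘ scalar (+ ω)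
  incidenceᵀ*incidence p q with p ≟ q
  ... | yes refl = trans (sum-cong-≗ λ u → 𝟙-idem (lookup (e p) u)) (∑-incidence-column p)
  ... | no p≢q   = trans (sum-cong-≗ λ u → 𝟙-∧ (lookup (e p) u) (lookup (e q) u))
                         (trans common (sym (ℤP.+-identityʳ _)))
    where
    common : sum (λ u → 𝟙 (lookup (e p) u ∧ lookup (e q) u)) ≡ 𝟙 (does (nonempty? (e p ∩ e q)))
    common with nonempty? (e p ∩ e q)
    ... | yes (u , u∈) = ∑-𝟙-single _ u u∈p∩q at-most-u
      where
      u∈p∩q = trans (sym (lookup-∩ p q u)) ([]=⇒lookup u∈)
      at-most-u : ∀ v → (lookup (e p) v ∧ lookup (e q) v) ≡ true → v ≡ u
      at-most-u v v∈p∩q with v ≟ u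
      ... | yes v≡u = v≡u
      ... | no v≢u  = ⊥-elim (p≢q (edge-clique-unique (clique-adj p vp up v≢u) p q vp up vq uq))
        where
        vp = proj₁ (∧-true v∈p∩q)
        vq = proj₂ (∧-true v∈p∩q)
        up = proj₁ (∧-true u∈p∩q)
        uq = proj₂ (∧-true u∈p∩q)
    ... | no empty = ∑-zero _ λ v → cong 𝟙 (not-common v)
      where
      not-common : ∀ v → (lookup (e p) v ∧ lookup (e q) v) ≡ false
      not-common v with lookup (e p) v ∧ lookup (e q) v in v∈p∩q
      ... | true  = ⊥-elim (empty (v , lookup⇒[]= v (e p ∩ e q) (trans (lookup-∩ p q v) v∈p∩q)))
      ... | false = refl

  incidence*incidenceᵀ : ∀ u v → (incidence *ₘ incidence ᵀ) u v ≡ adjMatrix G u v + scalar (+ cliqueDegree u) u v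
  incidence*incidenceᵀ u v with u ≟ v
  ... | yes refl = trans (sum-cong-≗ λ i → 𝟙-idem (lookup (e i) u))
                         (trans (∑-incidence-row u) (sym (cong (λ b → 𝟙 b + + cliqueDegree u) (irrefl G u))))
  ... | no u≢v   = trans (sum-cong-≗ λ i → 𝟙-∧ (lookup (e i) u) (lookup (e i) v))
                         (trans edge-count (sym (ℤP.+-identityʳ _)))
    where
    edge-count : sum (λ i → 𝟙 (lookup (e i) u ∧ lookup (e i) v)) ≡ adjMatrix G u v
    edge-count with adj G u v in uv
    ... | true with proj₁ (proj₂ CR u v uv)
    ...   | S , S-isClique , u∈S , v∈S with proj₂ (proj₂ enum) S S-isClique
    ...     | i₀ , eᵢ₀≡S = ∑-𝟙-single _ i₀ (cong₂ _∧_ (in-i₀ u∈S) (in-i₀ v∈S)) only-i₀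
      where
      in-i₀ : ∀ {w} → w ∈ S → lookup (e i₀) w ≡ true
      in-i₀ w∈S = trans (cong (λ T → lookup T _) eᵢ₀≡S) ([]=⇒lookup w∈S)
      only-i₀ : ∀ i → (lookup (e i) u ∧ lookup (e i) v) ≡ true → i ≡ i₀
      only-i₀ i uv∈i = edge-clique-unique uv i i₀ (proj₁ (∧-true uv∈i)) (proj₂ (∧-true uv∈i)) (in-i₀ u∈S) (in-i₀ v∈S)
    edge-count | false = ∑-zero _ λ i → cong 𝟙 (not-both i)
      where
      not-both : ∀ i → (lookup (e i) u ∧ lookup (e i) v) ≡ false
      not-both i with lookup (e i) u ∧ lookup (e i) v in uv∈i
      ... | true  = contradiction (trans (sym uv) (clique-adj i (proj₁ (∧-true uv∈i)) (proj₂ (∧-true uv∈i)) u≢v)) λ ()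
      ... | false = refl

  degree+cliqueDegree : ∀ u → degree G u ℕ.+ cliqueDegree u ≡ ω ℕ.* cliqueDegree u
  degree+cliqueDegree u = ℤP.+-injective (begin
    + (degree G u ℕ.+ ρ)                                       ≡⟨ ℤP.pos-+ (degree G u) ρ ⟩
    + degree G u + + ρ                                         ≡⟨ cong₂ _+_ degree-as-sum (sym (∑-scalar-row (+ ρ) u)) ⟩
    sum (adjMatrix G u) + sum (scalar (+ ρ) u)                 ≡⟨ ∑-distrib-+ (adjMatrix G u) (scalar (+ ρ) u) ⟨
    sum (λ v → adjMatrix G u v + scalar (+ ρ) u v)             ≡⟨ sum-cong-≗ (incidence*incidenceᵀ u) ⟨
    sum (λ v → sum (λ i → incidence u i * incidence v i))      ≡⟨ ∑-comm (λ v i → incidence u i * incidence v i) ⟩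
    sum (λ i → sum (λ v → incidence u i * incidence v i))      ≡⟨ sum-cong-≗ (λ i → *-distribˡ-sum (incidence u i) (λ v → incidence v i)) ⟨
    sum (λ i → incidence u i * sum (λ v → incidence v i))      ≡⟨ sum-cong-≗ (λ i → cong (incidence u i *_) (∑-incidence-column i)) ⟩
    sum (λ i → incidence u i * + ω)                            ≡⟨ *-distribʳ-sum (+ ω) (incidence u) ⟨
    sum (incidence u) * + ω                                    ≡⟨ cong (_* + ω) (∑-incidence-row u) ⟩
    + ρ * + ω                                                  ≡⟨ ℤP.*-comm (+ ρ) (+ ω) ⟩
    + ω * + ρ                                                  ≡⟨ ℤP.pos-* ω ρ ⟨
    + (ω ℕ.* ρ)                                                ∎)
    where
    open ≡-Reasoning
    ρ = cliqueDegree u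
    degree-as-sum : + degree G u ≡ sum (adjMatrix G u)
    degree-as-sum = trans (+-sumℕ λ v → if adj G u v then 1 else 0) (sum-cong-≗ λ v → 𝟙-pos (adj G u v))

  charPolyAt-cliqueGraph : ∀ λ′ → charPolyAt (cliqueGraphAdj e) λ′ ≡ charPolyAt (incidence ᵀ *ₘ incidence) (λ′ + + ω)
  charPolyAt-cliqueGraph λ′ = sym (trans (charPolyAt-shift (+ ω) (λ′ + + ω) incidenceᵀ*incidence)
                                         (cong (charPolyAt (cliqueGraphAdj e)) (add-sub λ′ (+ ω))))
    where add-sub : ∀ a b → a + b - b ≡ a
          add-sub = solve-∀

  ∑-cliqueDegree : sum (λ u → + cliqueDegree u) ≡ + N * + ω
  ∑-cliqueDegree = begin
    sum (λ u → + cliqueDegree u)             ≡⟨ sum-cong-≗ ∑-incidence-row ⟨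
    sum (λ u → sum (incidence u))            ≡⟨ ∑-comm incidence ⟩
    sum (λ i → sum (λ u → incidence u i))    ≡⟨ sum-cong-≗ ∑-incidence-column ⟩
    ∑[ i < N ] (+ ω)                         ≡⟨ ∑-const N (+ ω) ⟩
    + N * + ω                                ∎
    where open ≡-Reasoning

module RegularCliqueIncidence {n k w N} (G : Graph n) (reg : IsRegular G k) (CR : IsCliqueRegular G (suc (suc w)))
                              (e : Fin N → Subset n) (enum : IsCliqueEnumeration G (suc (suc w)) N e) where

  open CliqueIncidence G CR e enum public

  k≡[1+w]*cliqueDegree : ∀ u → k ≡ suc w ℕ.* cliqueDegree u
  k≡[1+w]*cliqueDegree u = ℕP.+-cancelˡ-≡ (cliqueDegree u) k (suc w ℕ.* cliqueDegree u)
    (trans (ℕP.+-comm (cliqueDegree u) k) (trans (cong (ℕ._+ cliqueDegree u) (sym (reg u))) (degree+cliqueDegree u)))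

  cliqueDegree-regular : ∀ u → cliqueDegree u ≡ k / suc w
  cliqueDegree-regular u = sym (trans (cong (_/ suc w) (trans (k≡[1+w]*cliqueDegree u) (ℕP.*-comm (suc w) (cliqueDegree u))))
                                      (m*n/n≡m (cliqueDegree u) (suc w)))

  incidence*incidenceᵀ-regular : incidence *ₘ incidence ᵀ ≋ adjMatrix G +ₘ scalar (+ (k / suc w))
  incidence*incidenceᵀ-regular u v =
    trans (incidence*incidenceᵀ u v) (cong (λ c → adjMatrix G u v + scalar (+ c) u v) (cliqueDegree-regular u))

  charPolyAt-graph : ∀ x → charPolyAt (incidence *ₘ incidence ᵀ) x ≡ charPolyAt (adjMatrix G) (x - + (k / suc w))
  charPolyAt-graph x = charPolyAt-shift (+ (k / suc w)) x incidence*incidenceᵀ-regular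

  clique-count : divℕ (n ℕ.* k) (suc (suc w) ℕ.* suc w) ≡ N
  clique-count = trans (cong (λ z → divℕ z (ω ℕ.* suc w)) n*k≡N*ω*[1+w]) (m*n/n≡m N (ω ℕ.* suc w))
    where
    ω = suc (suc w)
    n*k≡N*ω*[1+w] : n ℕ.* k ≡ N ℕ.* (ω ℕ.* suc w)
    n*k≡N*ω*[1+w] = ℤP.+-injective (begin
      + (n ℕ.* k)                              ≡⟨ ℤP.pos-* n k ⟩
      + n * + k                                ≡⟨ ∑-const n (+ k) ⟨
      ∑[ u < n ] (+ k)                         ≡⟨ sum-cong-≗ (λ u → trans (cong +_ (k≡[1+w]*cliqueDegree u)) (ℤP.pos-* (suc w) (cliqueDegree u))) ⟩
      sum (λ u → + suc w * + cliqueDegree u)   ≡⟨ *-distribˡ-sum (+ suc w) (λ u → + cliqueDegree u) ⟨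
      + suc w * sum (λ u → + cliqueDegree u)   ≡⟨ cong (+ suc w *_) ∑-cliqueDegree ⟩
      + suc w * (+ N * + ω)                    ≡⟨ rearrange (+ suc w) (+ N) (+ ω) ⟩
      + N * (+ ω * + suc w)                    ≡⟨ cong (+ N *_) (ℤP.pos-* ω (suc w)) ⟨
      + N * + (ω ℕ.* suc w)                    ≡⟨ ℤP.pos-* N (ω ℕ.* suc w) ⟨
      + (N ℕ.* (ω ℕ.* suc w))                  ∎)
      where
      open ≡-Reasoning
      rearrange : ∀ a b c → a * (b * c) ≡ b * (c * a)
      rearrange = solve-∀

theorem3p5 : (n k ω : ℕ) (G : Graph n) → IsRegular G k → 2 ≤ ω → IsCliqueRegular G ω →
    (N : ℕ) (e : Fin N → Subset n) → IsCliqueEnumeration G ω N e →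
    let m = divℕ (n ℕ.* k) (ω ℕ.* (ω ∸ 1))
        r = divℕ k (ω ∸ 1)
    in (λ' : ℤ) →
      (n ≤ m → charPolyAt (cliqueGraphAdj e) λ'
                 ≡ ((λ' ℤ.+ + ω) ℤ.^ (m ∸ n)) ℤ.* charPolyAt (adjMatrix G) ((λ' ℤ.+ + ω) ℤ.- + r)) ×
      (m ≤ n → ((λ' ℤ.+ + ω) ℤ.^ (n ∸ m)) ℤ.* charPolyAt (cliqueGraphAdj e) λ'
                 ≡ charPolyAt (adjMatrix G) ((λ' ℤ.+ + ω) ℤ.- + r))
theorem3p5 n k .(suc (suc w)) G reg (s≤s (s≤s (z≤n {w}))) CR N e enum λ′ =
  (λ n≤m → begin
    charPolyAt (cliqueGraphAdj e) λ′                  ≡⟨ charPolyAt-cliqueGraph λ′ ⟩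
    charPolyAt (M ᵀ *ₘ M) x                           ≡⟨ charPolyAt-ᵀ*ₘ M x (subst (n ≤_) clique-count n≤m) ⟩
    x ^ (N ∸ n) * charPolyAt (M *ₘ M ᵀ) x             ≡⟨ cong₂ (λ d p → x ^ (d ∸ n) * p) (sym clique-count) (charPolyAt-graph x) ⟩
    x ^ (divℕ (n ℕ.* k) (suc (suc w) ℕ.* suc w) ∸ n) * charPolyAt (adjMatrix G) (x - + (k / suc w)) ∎) ,
  (λ m≤n → begin
    x ^ (n ∸ divℕ (n ℕ.* k) (suc (suc w) ℕ.* suc w)) * charPolyAt (cliqueGraphAdj e) λ′
      ≡⟨ cong₂ (λ d p → x ^ (n ∸ d) * p) clique-count (charPolyAt-cliqueGraph λ′) ⟩
    x ^ (n ∸ N) * charPolyAt (M ᵀ *ₘ M) x             ≡⟨ charPolyAt-ᵀ*ₘ (M ᵀ) x (subst (_≤ n) clique-count m≤n) ⟨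
    charPolyAt (M *ₘ M ᵀ) x                           ≡⟨ charPolyAt-graph x ⟩
    charPolyAt (adjMatrix G) (x - + (k / suc w))      ∎)
  where
  open ≡-Reasoning
  open RegularCliqueIncidence G reg CR e enum renaming (incidence to M)
  x = λ′ + + suc (suc w)
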